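{- Let $r,n$ be positive integers and let $\mathbb{F}_2[\mathbf{x}]$ be the polynomial ring over $\mathbb{F}_2$ in the variables $\mathbf{x}=\{x_{ijk}: i,j\in[r], k\in[n]\}$. Let $I_{r,n}$ be the ideal generated by the polynomials $x_{ijk}(x_{ijk}-1)$, $x_{ijk}x_{i'jk}$, $x_{ijk}x_{ij'k}$, $x_{ijk}x_{ijk'}$ for all $i,j\in[r]$, $k\in[n]$, $i'\in\{i+1,\ldots,r\}$, $j'\in\{j+1,\ldots,r\}$, $k'\in\{k+1,\ldots,n\}$, together with the polynomials $x_{ijp}\,x_{klp}\,x_{jiq}\,x_{lkq}$ for all $i,j,k,l\in[r]$ and $p,q\in[n]$ with $(i,j)\neq(k,l)$. Then $I_{r,n}$ is zero-dimensional, and the map sending $P=(p_{ij})\in\mathcal{SOR}_{r,n}$ to the point of $\mathbb{F}_2^{r^2n}$ with $x_{ijk}=1$ if $p_{ij}=k$ and $x_{ijk}=0$ otherwise is a bijection from $\mathcal{SOR}_{r,n}$ onto the set of common zeros of $I_{r,n}$. Moreover, $|\mathcal{SOR}_{r,n}|=\dim_{\mathbb{F}_2}(\mathbb{F}_2[\mathbf{x}]/I_{r,n})$ and, for every $m\geq 0$, $|\mathcal{SOR}_{r,n:m}|=\mathrm{HF}_{\mathbb{F}_2[\mathbf{x}]/I_{r,n}}(m)$.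
   Context: An $r\times s$ partial Latin rectangle based on $[n]=\{1,\ldots,n\}$ is an $r\times s$ array in which each cell is either empty or contains a symbol of $[n]$, such that each symbol occurs at most once in each row and in each column; its size is its number of filled cells. Two such arrays $P=(p_{ij}),Q=(q_{ij})$ of the same dimensions are orthogonal if whenever $p_{ij}=p_{i'j'}\in[n]$ for cells $(i,j)\neq(i',j')$, the entries $q_{ij}$ and $q_{i'j'}$ are not the same symbol of $[n]$. An $r\times r$ partial Latin rectangle is self-orthogonal if it is orthogonal to its transpose. $\mathcal{SOR}_{r,n}$ is the set of self-orthogonal $r\times r$ partial Latin rectangles based on $[n]$ and $\mathcal{SOR}_{r,n:m}$ its subset of those of size $m$. For an ideal $I$ of a polynomial ring $R$ and the lexicographic term order, a standard monomial of $I$ is a monomial not in the initial ideal of $I$; $\mathrm{HF}_{R/I}(d)$ denotes the number of standard monomials of $I$ of degree $d$. -}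

module Defs where

open import Data.Nat using (ℕ; zero; suc; _+_; _<_; _≟_)
open import Data.Fin as F using (Fin)
open import Data.Fin.Properties using (all?)
open import Data.Bool using (Bool; true; false; _∧_; _xor_; not; if_then_else_)
open import Data.Maybe using (Maybe; just; nothing)
open import Data.List using (List; []; _∷_; _++_; map; concatMap; foldr; allFin)
open import Data.Bool.ListAction using (and)
open import Data.Nat.ListAction using (sum)
open import Data.List.Relation.Unary.All using (All)
open import Data.Vec as V using (Vec)
open import Data.Product using (Σ; ∃; _×_; _,_; proj₁; proj₂)
open import Data.Sum using (_⊎_)
open import Relation.Binary.PropositionalEquality using (_≡_)
open import Relation.Nullary using (¬_; Dec; does)

-- Partial Latin rectangles (symbols [n] = Fin n, empty cell = nothing)

Array : ℕ → ℕ → Set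
Array r n = Fin r → Fin r → Maybe (Fin n)

IsPartialLatin : ∀ {r n} → Array r n → Set
IsPartialLatin {r} {n} P =
  (∀ (i j j' : Fin r) (s : Fin n) → P i j ≡ just s → P i j' ≡ just s → j ≡ j')
  × (∀ (i i' j : Fin r) (s : Fin n) → P i j ≡ just s → P i' j ≡ just s → i ≡ i')

Orthogonal : ∀ {r n} → Array r n → Array r n → Set
Orthogonal {r} {n} P Q =
  ∀ (i j i' j' : Fin r) (s t : Fin n) →
    P i j ≡ just s → P i' j' ≡ just s →
    Q i j ≡ just t → Q i' j' ≡ just t →
    (i , j) ≡ (i' , j')

transpose : ∀ {r n} → Array r n → Array r n
transpose P i j = P j i

IsSOR : ∀ {r n} → Array r n → Set
IsSOR P = IsPartialLatin P × Orthogonal P (transpose P)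

filled : ∀ {n} → Maybe (Fin n) → ℕ
filled nothing  = 0
filled (just _) = 1

size : ∀ {r n} → Array r n → ℕ
size {r} P = sum (map (λ i → sum (map (λ j → filled (P i j)) (allFin r))) (allFin r))

IsSORm : ∀ {r n} → ℕ → Array r n → Set
IsSORm m P = IsSOR P × size P ≡ m

HasCard : {A : Set} → (A → A → Set) → (A → Set) → ℕ → Set
HasCard {A} _≈_ Pr c =
  Σ (Vec A c) λ xs →
    (∀ k → Pr (V.lookup xs k))
    × (∀ k l → V.lookup xs k ≈ V.lookup xs l → k ≡ l)
    × (∀ a → Pr a → ∃ λ k → a ≈ V.lookup xs k)

_≈ₐ_ : ∀ {r n} → Array r n → Array r n → Set
P ≈ₐ Q = ∀ i j → P i j ≡ Q i j

Mon : ℕ → ℕ → Set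
Mon r n = Fin r → Fin r → Fin n → ℕ

_≈ₘ_ : ∀ {r n} → Mon r n → Mon r n → Set
m ≈ₘ m' = ∀ i j k → m i j k ≡ m' i j k

_≈ₘ?_ : ∀ {r n} (m m' : Mon r n) → Dec (m ≈ₘ m')
m ≈ₘ? m' = all? λ i → all? λ j → all? λ k → m i j k ≟ m' i j k

_·ₘ_ : ∀ {r n} → Mon r n → Mon r n → Mon r n
(a ·ₘ b) i j k = a i j k + b i j k

oneₘ : ∀ {r n} → Mon r n
oneₘ _ _ _ = 0

varₘ : ∀ {r n} → Fin r → Fin r → Fin n → Mon r n
varₘ i j k i' j' k' =
  if does (i F.≟ i') ∧ does (j F.≟ j') ∧ does (k F.≟ k') then 1 else 0

-- a polynomial over F₂ is a formal sum of monomials (listed with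
-- multiplicity; the coefficient of a monomial is the parity of its multiplicity)
Poly : ℕ → ℕ → Set
Poly r n = List (Mon r n)

coeff : ∀ {r n} → Poly r n → Mon r n → Bool
coeff p m = foldr (λ m' b → if does (m' ≈ₘ? m) then not b else b) false p

_≈ₚ_ : ∀ {r n} → Poly r n → Poly r n → Set
p ≈ₚ q = ∀ m → coeff p m ≡ coeff q m

0ₚ : ∀ {r n} → Poly r n
0ₚ = []

1ₚ : ∀ {r n} → Poly r n
1ₚ = oneₘ ∷ []

_+ₚ_ : ∀ {r n} → Poly r n → Poly r n → Poly r n
p +ₚ q = p ++ q

_*ₚ_ : ∀ {r n} → Poly r n → Poly r n → Poly r n
p *ₚ q = concatMap (λ a → map (a ·ₘ_) q) p

-- over F₂, subtraction is addition: (x - 1) = x + 1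
_-ₚ_ : ∀ {r n} → Poly r n → Poly r n → Poly r n
p -ₚ q = p +ₚ q

x : ∀ {r n} → Fin r → Fin r → Fin n → Poly r n
x i j k = varₘ i j k ∷ []

data IsGen (r n : ℕ) : Poly r n → Set where
  g-bool : ∀ i j k → IsGen r n (x i j k *ₚ (x i j k -ₚ 1ₚ))
  g-col  : ∀ i i' j k → i F.< i' → IsGen r n (x i j k *ₚ x i' j k)
  g-row  : ∀ i j j' k → j F.< j' → IsGen r n (x i j k *ₚ x i j' k)
  g-cell : ∀ i j k k' → k F.< k' → IsGen r n (x i j k *ₚ x i j k')
  g-orth : ∀ i j k l p q → ¬ ((i , j) ≡ (k , l)) →
           IsGen r n (((x i j p *ₚ x k l p) *ₚ x j i q) *ₚ x l k q)

InI : ∀ {r n} → Poly r n → Set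
InI {r} {n} f =
  Σ (List (Poly r n × Poly r n)) λ cs →
    All (λ hg → IsGen r n (proj₂ hg)) cs
    × f ≈ₚ foldr (λ hg acc → (proj₁ hg *ₚ proj₂ hg) +ₚ acc) 0ₚ cs

Point : ℕ → ℕ → Set
Point r n = Fin r → Fin r → Fin n → Bool

pow : Bool → ℕ → Bool
pow b zero    = true
pow b (suc e) = b ∧ pow b e

evalₘ : ∀ {r n} → Point r n → Mon r n → Bool
evalₘ {r} {n} a m =
  and (concatMap (λ i → concatMap (λ j → map (λ k → pow (a i j k) (m i j k))
        (allFin n)) (allFin r)) (allFin r))

eval : ∀ {r n} → Point r n → Poly r n → Bool
eval a p = foldr (λ m b → evalₘ a m xor b) false p

IsZeroOfI : ∀ {r n} → Point r n → Set
IsZeroOfI {r} {n} a = ∀ (f : Poly r n) → InI f → eval a f ≡ false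

encode : ∀ {r n} → Array r n → Point r n
encode P i j k with P i j
... | nothing = false
... | just s  = does (s F.≟ k)

lincomb : ∀ {r n d} → Vec Bool d → Vec (Poly r n) d → Poly r n
lincomb V.[] V.[] = 0ₚ
lincomb (c V.∷ cs) (b V.∷ bs) = (if c then b else 0ₚ) +ₚ lincomb cs bs

HasQuotientDim : (r n d : ℕ) → Set
HasQuotientDim r n d =
  Σ (Vec (Poly r n) d) λ bs →
    (∀ (f : Poly r n) → ∃ λ (cs : Vec Bool d) → InI (f -ₚ lincomb cs bs))
    × (∀ (cs : Vec Bool d) → InI (lincomb cs bs) → cs ≡ V.replicate d false)

ZeroDimensional : (r n : ℕ) → Set
ZeroDimensional r n = ∃ λ d → HasQuotientDim r n d

-- exponent vector listed in the variable order x_111 > x_112 > ... (i, then j, then k)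
flat : ∀ {r n} → Mon r n → List ℕ
flat {r} {n} m =
  concatMap (λ i → concatMap (λ j → map (λ k → m i j k)
    (allFin n)) (allFin r)) (allFin r)

data LexLt : List ℕ → List ℕ → Set where
  here  : ∀ {a b xs ys} → a < b → LexLt (a ∷ xs) (b ∷ ys)
  there : ∀ {a xs ys} → LexLt xs ys → LexLt (a ∷ xs) (a ∷ ys)

_≤lex_ : ∀ {r n} → Mon r n → Mon r n → Set
m ≤lex m' = LexLt (flat m) (flat m') ⊎ m ≈ₘ m'

IsLeadMon : ∀ {r n} → Poly r n → Mon r n → Set
IsLeadMon f m = coeff f m ≡ true × (∀ m' → coeff f m' ≡ true → m' ≤lex m)

InInitial : ∀ {r n} → Mon r n → Set
InInitial {r} {n} m = ∃ λ (f : Poly r n) → InI f × ∃ λ m' → IsLeadMon f m' × ∃ λ u → (u ·ₘ m') ≈ₘ m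

deg : ∀ {r n} → Mon r n → ℕ
deg m = sum (flat m)

IsStandardOfDeg : ∀ {r n} → ℕ → Mon r n → Set
IsStandardOfDeg d m = ¬ InInitial m × deg m ≡ d

module Submission where

-- Call a point a ∈ F₂^{r²n} good if every generator of I_{r,n} vanishes at a.  The
-- proof combines three facts, developed in this order after some list and parity
-- sum bookkeeping (linear functionals over F₂ are parity sums over monomials).
--  (1) The zeros of I are the good points, and encode/decode identify the good
--      points with SOR_{r,n}; this gives the bijection SOR_{r,n} ≅ V(I).
--  (2) Reduction: modulo I each monomial μ is congruent to x^{supp μ}, and μ ∈ I
--      when supp μ is not good.  So the x^{encode P}, P ∈ SOR_{r,n}, span F₂[x]/I.
--  (3) Duality: for good b the functional f ↦ Σ_{a ≤ b} eval a f vanishes on I and,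
--      by Möbius inversion over F₂, counts mod 2 the monomials of f with support
--      exactly b.  Hence the x^{encode P} are linearly independent modulo I and are
--      standard monomials, while every standard monomial is some x^{encode P}.
-- Counting an explicit enumeration of SOR_{r,n} (graded by size = degree) then
-- yields the dimension and Hilbert function statements.

open import Defs
open import Level using (0ℓ)
open import Data.Nat using (ℕ; zero; suc; _+_; _<_; _≤_; z≤n; s≤s) renaming (_≟_ to _≟ℕ_)
open import Data.Nat.Properties using (+-comm; +-identityʳ; +-suc; 1+n≢0; ≤-trans; ≤-reflexive; m≤n+m; m≤n⇒m<n∨m≡n; <⇒≱)
open import Data.Nat.ListAction using (sum)
open import Data.Nat.ListAction.Properties using (sum-++)
open import Data.Fin as Fin using (Fin)
open import Data.Fin.Properties using (any?; all?; <-cmp; <⇒≢; _<?_; suc-injective) renaming (_≟_ to _≟ᶠ_)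
open import Data.Bool using (Bool; true; false; _∧_; _xor_; not; if_then_else_)
open import Data.Bool.Properties
  using (xor-assoc; xor-comm; xor-same; xor-identityʳ; ∧-assoc; ∧-comm; ∧-identityʳ; ∧-zeroʳ; ∧-distribˡ-xor; ⇔→≡)
  renaming (_≟_ to _≟ᵇ_)
open import Data.Bool.ListAction using (and)
open import Data.Bool.Solver using (module xor-∧-Solver)
open import Data.Maybe using (Maybe; just; nothing)
import Data.Maybe.Properties as Maybe
open import Data.List using (List; []; _∷_; _++_; map; concatMap; foldr; allFin; tabulate; filter; deduplicate; length)
open import Data.List.Properties
  using (map-cong; map-cong-local; map-∘; map-concatMap; concatMap-cong; map-tabulate; length-map;
         ++-assoc; ++-identityʳ; filter-notAll; filter-accept; filter-reject)
open import Data.List.Membership.Propositional using (_∈_; lose)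
open import Data.List.Membership.Propositional.Properties using (∈-allFin; ∈-map⁺; ∈-concatMap⁺; ∈-deduplicate⁺)
open import Data.List.Relation.Binary.Pointwise using (Pointwise; []; _∷_)
open import Data.List.Relation.Unary.All as All using (All; []; _∷_)
import Data.List.Relation.Unary.All.Properties as AllP
open import Data.List.Relation.Unary.Any as Any using (Any; here; there)
import Data.List.Relation.Unary.Any.Properties as AnyP
open import Data.List.Relation.Unary.AllPairs as AllPairs using (AllPairs; []; _∷_)
import Data.List.Relation.Unary.AllPairs.Properties as AllPairsP
open import Data.List.Relation.Unary.Unique.Propositional using (Unique)
import Data.List.Relation.Unary.Unique.DecPropositional.Properties as UniqueProp
import Data.List.Relation.Unary.Unique.DecSetoid.Properties as UniqueSetoid
open import Data.Vec as Vec using (Vec; lookup; replicate; zipWith)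
open import Data.Vec.Properties using (lookup-map)
open import Data.Product using (Σ; ∃; _×_; _,_; proj₁; proj₂)
open import Data.Product.Properties using (≡-dec)
open import Data.Sum using (_⊎_; inj₁; inj₂)
open import Data.Empty using (⊥; ⊥-elim)
open import Function using (_∘_; _∘′_; _⇔_; mk⇔; Equivalence)
open import Relation.Binary.Bundles using (DecSetoid)
open import Relation.Binary.Definitions using (tri<; tri≈; tri>)
open import Relation.Binary.PropositionalEquality
open import Relation.Nullary using (¬_; Dec; yes; no; does)
open import Relation.Nullary.Decidable using (map′; _×-dec_; ¬?; dec-true)

open xor-∧-Solver using (solve; _:+_; _:*_; _:=_)

true≢false : ¬ true ≡ false
true≢false ()

xor-false⇒≡ : ∀ a b → a xor b ≡ false → a ≡ b
xor-false⇒≡ false b    e = sym e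
xor-false⇒≡ true  true _ = refl

∧-true⇒ʳ : ∀ {a b} → a ∧ b ≡ true → b ≡ true
∧-true⇒ʳ {true} e = e

¬true⇒false : ∀ {b} → ¬ b ≡ true → b ≡ false
¬true⇒false {true}  ne = ⊥-elim (ne refl)
¬true⇒false {false} _  = refl

not-both : ∀ {u v} → (u ≡ true → v ≡ true → ⊥) → u ∧ v ≡ false
not-both {true} {true}  h = ⊥-elim (h refl refl)
not-both {true} {false} _ = refl
not-both {false}        _ = refl

true-true-false : ∀ {u v} → u ∧ v ≡ false → u ≡ true → v ≡ true → ⊥
true-true-false h refl refl with () ← h

both : ∀ {u v} → u ≡ true → v ≡ true → u ∧ v ≡ true
both refl refl = refl

does-cong : ∀ {A B : Set} → (A → B) → (B → A) → (a? : Dec A) (b? : Dec B) → does a? ≡ does b?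
does-cong f g (yes a) (yes b) = refl
does-cong f g (yes a) (no ¬b) = ⊥-elim (¬b (f a))
does-cong f g (no ¬a) (yes b) = ⊥-elim (¬a (g b))
does-cong f g (no ¬a) (no ¬b) = refl

does-true : ∀ {A : Set} (a? : Dec A) → does a? ≡ true → A
does-true (yes a) _ = a

-- Over F₂ a polynomial is a list of monomials, and every
-- function G on monomials induces the linear functional
-- p ↦ parity G p = Σ_{μ ∈ p} G μ; evaluation and coefficients are of this form.
parity : {A : Set} → (A → Bool) → List A → Bool
parity G = foldr (λ a b → G a xor b) false

module _ {A : Set} where

  parity-++ : (G : A → Bool) (p q : List A) → parity G (p ++ q) ≡ parity G p xor parity G q
  parity-++ G []      q = refl
  parity-++ G (a ∷ p) q = trans (cong (G a xor_) (parity-++ G p q)) (sym (xor-assoc (G a) _ _))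

  parity-cong : {G H : A → Bool} → (∀ a → G a ≡ H a) → (p : List A) → parity G p ≡ parity H p
  parity-cong e []      = refl
  parity-cong e (a ∷ p) = cong₂ _xor_ (e a) (parity-cong e p)

  parity-∧ : (c : Bool) (G : A → Bool) (p : List A) → parity (λ a → c ∧ G a) p ≡ c ∧ parity G p
  parity-∧ c G []      = sym (∧-zeroʳ c)
  parity-∧ c G (a ∷ p) = trans (cong (c ∧ G a xor_) (parity-∧ c G p)) (sym (∧-distribˡ-xor c (G a) _))

  parity-∧ʳ : (G : A → Bool) (c : Bool) (p : List A) → parity (λ a → G a ∧ c) p ≡ parity G p ∧ c
  parity-∧ʳ G c p = trans (parity-cong (λ a → ∧-comm (G a) c) p) (trans (parity-∧ c G p) (∧-comm c _))

  parity-xor : (G H : A → Bool) (p : List A) → parity (λ a → G a xor H a) p ≡ parity G p xor parity H p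
  parity-xor G H []      = refl
  parity-xor G H (a ∷ p) rewrite parity-xor G H p = solve 4 (λ g h x y → (g :+ h) :+ (x :+ y) := (g :+ x) :+ (h :+ y)) refl (G a) (H a) (parity G p) (parity H p)

module _ {A B : Set} where

  parity-map : (G : B → Bool) (f : A → B) (p : List A) → parity G (map f p) ≡ parity (G ∘ f) p
  parity-map G f []      = refl
  parity-map G f (a ∷ p) = cong (G (f a) xor_) (parity-map G f p)

  parity-concatMap : (G : B → Bool) (f : A → List B) (p : List A) →
    parity G (concatMap f p) ≡ parity (λ a → parity G (f a)) p
  parity-concatMap G f []      = refl
  parity-concatMap G f (a ∷ p) = trans (parity-++ G (f a) (concatMap f p)) (cong (parity G (f a) xor_) (parity-concatMap G f p))

module _ {A : Set} where

  and-map⁻ : (f : A → Bool) {xs : List A} → and (map f xs) ≡ true → ∀ {a} → a ∈ xs → f a ≡ true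
  and-map⁻ f {b ∷ xs} e (here refl) with f b
  ... | true = refl
  and-map⁻ f {b ∷ xs} e (there m) with f b
  ... | true = and-map⁻ f e m

  and-map⁺ : (f : A → Bool) → (∀ a → f a ≡ true) → ∀ xs → and (map f xs) ≡ true
  and-map⁺ f h []       = refl
  and-map⁺ f h (a ∷ xs) rewrite h a = and-map⁺ f h xs

  and-map-∧ : (f g : A → Bool) (xs : List A) → and (map (λ a → f a ∧ g a) xs) ≡ and (map f xs) ∧ and (map g xs)
  and-map-∧ f g []       = refl
  and-map-∧ f g (a ∷ xs) rewrite and-map-∧ f g xs = solve 4 (λ x y u v → (x :* y) :* (u :* v) := (x :* u) :* (y :* v)) refl (f a) (g a) _ _

module _ {A : Set} where

  lex-map : (f g : A → ℕ) → (∀ a → f a ≤ g a) → ∀ {xs a} → a ∈ xs → f a < g a → LexLt (map f xs) (map g xs)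
  lex-map f g f≤g {b ∷ xs} (here refl) lt = here lt
  lex-map f g f≤g {b ∷ xs} (there m)   lt with m≤n⇒m<n∨m≡n (f≤g b)
  ... | inj₁ fb<gb = here fb<gb
  ... | inj₂ fb≡gb rewrite fb≡gb = there (lex-map f g f≤g m lt)

  no-lex-map : (f g : A → ℕ) → (∀ a → g a ≤ f a) → ∀ xs → ¬ LexLt (map f xs) (map g xs)
  no-lex-map f g g≤f xs = no-lex (pointwise xs)
    where
    pointwise : ∀ xs → Pointwise (λ u v → v ≤ u) (map f xs) (map g xs)
    pointwise []       = []
    pointwise (a ∷ xs) = g≤f a ∷ pointwise xs
    no-lex : ∀ {us vs} → Pointwise (λ u v → v ≤ u) us vs → ¬ LexLt us vs
    no-lex (v≤u ∷ _) (here u<v) = <⇒≱ u<v v≤u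
    no-lex (_ ∷ ps)  (there l)  = no-lex ps l

-- Variables x_ijk, indexed by triples.  The traversal T3 lists the values of a
-- triply indexed family in the variable order fixed in Defs (used by evalₘ, flat, deg).
module _ {r n : ℕ} where

  Var : Set
  Var = Fin r × Fin r × Fin n

  _≟ᵥ_ : (v w : Var) → Dec (v ≡ w)
  (i , j , k) ≟ᵥ (i' , j' , k') =
    map′ (λ { (refl , refl , refl) → refl }) (λ { refl → refl , refl , refl }) (i ≟ᶠ i' ×-dec (j ≟ᶠ j' ×-dec k ≟ᶠ k'))

  _⟨_⟩ : {A : Set} → (Fin r → Fin r → Fin n → A) → Var → A
  F ⟨ i , j , k ⟩ = F i j k

  T3 : {A : Set} → (Fin r → Fin r → Fin n → A) → List A
  T3 F = concatMap (λ i → concatMap (λ j → map (F i j) (allFin n)) (allFin r)) (allFin r)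

  vars : List Var
  vars = T3 λ i j k → i , j , k

  T3-vars : {A : Set} (F : Fin r → Fin r → Fin n → A) → T3 F ≡ map (F ⟨_⟩) vars
  T3-vars F = sym (trans (map-concatMap _ _ (allFin r)) (concatMap-cong (λ i →
    trans (map-concatMap _ _ (allFin r)) (concatMap-cong (λ j → sym (map-∘ (allFin n))) (allFin r))) (allFin r)))

  ∈-vars : ∀ v → v ∈ vars
  ∈-vars (i , j , k) = ∈-concatMap⁺ _ (lose (∈-allFin i) (∈-concatMap⁺ _ (lose (∈-allFin j) (∈-map⁺ _ (∈-allFin k)))))

  T3-cong : {A : Set} {F G : Fin r → Fin r → Fin n → A} → (∀ i j k → F i j k ≡ G i j k) → T3 F ≡ T3 G
  T3-cong {F = F} {G} e = trans (T3-vars F) (trans (map-cong (λ { (i , j , k) → e i j k }) vars) (sym (T3-vars G)))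

  and-T3 : (F : Fin r → Fin r → Fin n → Bool) → and (T3 F) ≡ true ⇔ (∀ i j k → F i j k ≡ true)
  and-T3 F = mk⇔
    (λ e i j k → and-map⁻ (F ⟨_⟩) (subst (λ l → and l ≡ true) (T3-vars F) e) (∈-vars (i , j , k)))
    (λ h → subst (λ l → and l ≡ true) (sym (T3-vars F)) (and-map⁺ (F ⟨_⟩) (λ { (i , j , k) → h i j k }) vars))

  and-T3-∧ : (F G : Fin r → Fin r → Fin n → Bool) → and (T3 λ i j k → F i j k ∧ G i j k) ≡ and (T3 F) ∧ and (T3 G)
  and-T3-∧ F G rewrite T3-vars F | T3-vars G | T3-vars (λ i j k → F i j k ∧ G i j k) = and-map-∧ (F ⟨_⟩) (G ⟨_⟩) vars

module _ {r n : ℕ} where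

  ≈ₘ-refl : {μ : Mon r n} → μ ≈ₘ μ
  ≈ₘ-refl i j k = refl

  ≈ₘ-sym : {μ ν : Mon r n} → μ ≈ₘ ν → ν ≈ₘ μ
  ≈ₘ-sym e i j k = sym (e i j k)

  ≈ₘ-trans : {μ ν ρ : Mon r n} → μ ≈ₘ ν → ν ≈ₘ ρ → μ ≈ₘ ρ
  ≈ₘ-trans e f i j k = trans (e i j k) (f i j k)

  WellDefined : (Mon r n → Bool) → Set
  WellDefined G = ∀ {μ ν} → μ ≈ₘ ν → G μ ≡ G ν

  is : Mon r n → Mon r n → Bool
  is m μ = does (μ ≈ₘ? m)

  is-cases : ∀ (m μ : Mon r n) (P : Bool → Set) → (μ ≈ₘ m → P true) → (¬ μ ≈ₘ m → P false) → P (does (μ ≈ₘ? m))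
  is-cases m μ P y n = decide (μ ≈ₘ? m)
    where
    decide : (d : Dec (μ ≈ₘ m)) → P (does d)
    decide (yes e) = y e
    decide (no ne) = n ne

  is-wd : ∀ (m : Mon r n) → WellDefined (is m)
  is-wd m {μ} {ν} μ≈ν = does-cong (≈ₘ-trans (≈ₘ-sym μ≈ν)) (≈ₘ-trans μ≈ν) (μ ≈ₘ? m) (ν ≈ₘ? m)

  is-self : ∀ (m : Mon r n) → is m m ≡ true
  is-self m = dec-true (m ≈ₘ? m) ≈ₘ-refl

  coeff-parity : ∀ (p : Poly r n) m → coeff p m ≡ parity (is m) p
  coeff-parity []      m = refl
  coeff-parity (μ ∷ p) m rewrite coeff-parity p m = flip (is m μ) (parity (is m) p)
    where
    flip : ∀ c b → (if c then not b else b) ≡ c xor b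
    flip true  b = refl
    flip false b = refl

  coeff-++ : ∀ (p q : Poly r n) m → coeff (p ++ q) m ≡ coeff p m xor coeff q m
  coeff-++ p q m rewrite coeff-parity (p ++ q) m | coeff-parity p m | coeff-parity q m = parity-++ (is m) p q

  remove : Mon r n → Poly r n → Poly r n
  remove m = filter (λ μ → ¬? (μ ≈ₘ? m))

  parity-remove : ∀ G (m : Mon r n) p → parity G (remove m p) ≡ parity (λ μ → not (is m μ) ∧ G μ) p
  parity-remove G m []      = refl
  parity-remove G m (μ ∷ p) = is-cases m μ (λ b → parity G (remove m (μ ∷ p)) ≡ (not b ∧ G μ) xor rest)
    (λ μ≈m → trans (cong (parity G) (filter-reject (λ ν → ¬? (ν ≈ₘ? m)) λ μ≉m → μ≉m μ≈m)) (parity-remove G m p))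
    (λ μ≉m → trans (cong (parity G) (filter-accept (λ ν → ¬? (ν ≈ₘ? m)) μ≉m)) (cong (G μ xor_) (parity-remove G m p)))
    where rest = parity (λ μ → not (is m μ) ∧ G μ) p

  coeff-remove : ∀ (m : Mon r n) p m' → coeff (remove m p) m' ≡ not (is m m') ∧ coeff p m'
  coeff-remove m p m' = begin
    coeff (remove m p) m'                        ≡⟨ coeff-parity (remove m p) m' ⟩
    parity (is m') (remove m p)                  ≡⟨ parity-remove (is m') m p ⟩
    parity (λ μ → not (is m μ) ∧ is m' μ) p      ≡⟨ parity-cong pointwise p ⟩
    parity (λ μ → not (is m m') ∧ is m' μ) p     ≡⟨ parity-∧ (not (is m m')) (is m') p ⟩
    not (is m m') ∧ parity (is m') p             ≡⟨ cong (not (is m m') ∧_) (coeff-parity p m') ⟨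
    not (is m m') ∧ coeff p m'                   ∎
    where
    open ≡-Reasoning
    pointwise : ∀ μ → not (is m μ) ∧ is m' μ ≡ not (is m m') ∧ is m' μ
    pointwise μ = is-cases m' μ (λ b → not (is m μ) ∧ b ≡ not (is m m') ∧ b)
      (λ μ≈m' → cong (λ c → not c ∧ true) (is-wd m μ≈m')) (λ _ → trans (∧-zeroʳ _) (sym (∧-zeroʳ _)))

  module _ (G : Mon r n → Bool) (G-wd : WellDefined G) where

    parity-split : ∀ (m : Mon r n) p → parity G p ≡ (coeff p m ∧ G m) xor parity G (remove m p)
    parity-split m p = begin
      parity G p                                                     ≡⟨ parity-cong pointwise p ⟩
      parity (λ μ → (is m μ ∧ G m) xor (not (is m μ) ∧ G μ)) p       ≡⟨ parity-xor (λ μ → is m μ ∧ G m) (λ μ → not (is m μ) ∧ G μ) p ⟩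
      parity (λ μ → is m μ ∧ G m) p xor parity (λ μ → not (is m μ) ∧ G μ) p
        ≡⟨ cong₂ _xor_ (parity-∧ʳ (is m) (G m) p) (sym (parity-remove G m p)) ⟩
      (parity (is m) p ∧ G m) xor parity G (remove m p)             ≡⟨ cong (λ c → (c ∧ G m) xor parity G (remove m p)) (coeff-parity p m) ⟨
      (coeff p m ∧ G m) xor parity G (remove m p)                   ∎
      where
      open ≡-Reasoning
      pointwise : ∀ μ → G μ ≡ (is m μ ∧ G m) xor (not (is m μ) ∧ G μ)
      pointwise μ = is-cases m μ (λ b → G μ ≡ (b ∧ G m) xor (not b ∧ G μ))
        (λ μ≈m → trans (G-wd μ≈m) (sym (xor-identityʳ (G m)))) (λ _ → refl)

    parity-vanishes : ∀ (p : Poly r n) → (∀ μ → coeff p μ ≡ true → G μ ≡ false) → parity G p ≡ false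
    parity-vanishes p = go (length p) p ≤-refl′
      where
      ≤-refl′ : ∀ {m} → m ≤ m
      ≤-refl′ {zero} = z≤n
      ≤-refl′ {suc m} = s≤s ≤-refl′
      go : ∀ N p → length p ≤ N → (∀ μ → coeff p μ ≡ true → G μ ≡ false) → parity G p ≡ false
      go N       []      _  _ = refl
      go (suc N) (μ ∷ q) (s≤s l) h = begin
        parity G (μ ∷ q)                                              ≡⟨ parity-split μ (μ ∷ q) ⟩
        (coeff (μ ∷ q) μ ∧ G μ) xor parity G (remove μ (μ ∷ q))       ≡⟨ cong₂ _xor_ head-vanishes rest-vanishes ⟩
        false                                                         ∎
        where
        open ≡-Reasoning
        head-vanishes : coeff (μ ∷ q) μ ∧ G μ ≡ false
        head-vanishes with coeff (μ ∷ q) μ in c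
        ... | true  = h μ c
        ... | false = refl
        shorter : length (remove μ (μ ∷ q)) ≤ N
        shorter with filter-notAll (λ ν → ¬? (ν ≈ₘ? μ)) (μ ∷ q) (here (λ μ≉μ → μ≉μ ≈ₘ-refl))
        ... | s≤s lt = ≤-trans lt l
        rest-vanishes : parity G (remove μ (μ ∷ q)) ≡ false
        rest-vanishes = go N (remove μ (μ ∷ q)) shorter λ ν c → h ν (∧-true⇒ʳ (trans (sym (coeff-remove μ (μ ∷ q) ν)) c))

    parity-wd : ∀ {p q} → p ≈ₚ q → parity G p ≡ parity G q
    parity-wd {p} {q} p≈q = xor-false⇒≡ _ _ (trans (sym (parity-++ G p q)) (parity-vanishes (p ++ q) cancel))
      where
      cancel : ∀ μ → coeff (p ++ q) μ ≡ true → G μ ≡ false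
      cancel μ c with () ← trans (sym c) (trans (coeff-++ p q μ) (trans (cong (coeff p μ xor_) (sym (p≈q μ))) (xor-same (coeff p μ))))

module _ {r n : ℕ} where

  evalₘ-true : (a : Point r n) (μ : Mon r n) → evalₘ a μ ≡ true ⇔ (∀ i j k → pow (a i j k) (μ i j k) ≡ true)
  evalₘ-true a μ = and-T3 λ i j k → pow (a i j k) (μ i j k)

  evalₘ-wd : (a : Point r n) → WellDefined (evalₘ a)
  evalₘ-wd a e = cong and (T3-cong λ i j k → cong (pow (a i j k)) (e i j k))

  pow-+ : ∀ b e e' → pow b (e + e') ≡ pow b e ∧ pow b e'
  pow-+ b zero    e' = refl
  pow-+ b (suc e) e' = trans (cong (b ∧_) (pow-+ b e e')) (sym (∧-assoc b (pow b e) (pow b e')))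

  evalₘ-· : (a : Point r n) (μ ν : Mon r n) → evalₘ a (μ ·ₘ ν) ≡ evalₘ a μ ∧ evalₘ a ν
  evalₘ-· a μ ν = trans (cong and (T3-cong λ i j k → pow-+ (a i j k) (μ i j k) (ν i j k)))
                        (and-T3-∧ (λ i j k → pow (a i j k) (μ i j k)) (λ i j k → pow (a i j k) (ν i j k)))

  decide-var : (v w : Var {r} {n}) (P : Bool → Set) → (v ≡ w → P true) → (¬ v ≡ w → P false) → P (does (v ≟ᵥ w))
  decide-var v w P y n = decide (v ≟ᵥ w)
    where
    decide : (d : Dec (v ≡ w)) → P (does d)
    decide (yes e) = y e
    decide (no ne) = n ne

  evalₘ-var : (a : Point r n) → ∀ i j k → evalₘ a (varₘ i j k) ≡ a i j k
  evalₘ-var a i j k = ⇔→≡ {z = true} (mk⇔ to from)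
    where
    exponent-one : ∀ (b : Bool) → pow b 1 ≡ b
    exponent-one b = ∧-identityʳ b
    to : evalₘ a (varₘ i j k) ≡ true → a i j k ≡ true
    to e = decide-var (i , j , k) (i , j , k) (λ c → pow (a i j k) (if c then 1 else 0) ≡ true → a i j k ≡ true)
      (λ _ h → trans (sym (exponent-one (a i j k))) h) (λ ne → ⊥-elim (ne refl))
      (Equivalence.to (evalₘ-true a (varₘ i j k)) e i j k)
    from : a i j k ≡ true → evalₘ a (varₘ i j k) ≡ true
    from e = Equivalence.from (evalₘ-true a (varₘ i j k)) λ i' j' k' →
      decide-var (i , j , k) (i' , j' , k') (λ c → pow (a i' j' k') (if c then 1 else 0) ≡ true)
        (λ { refl → trans (exponent-one (a i j k)) e }) (λ _ → refl)

  evalₘ-one : (a : Point r n) → evalₘ a oneₘ ≡ true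
  evalₘ-one a = Equivalence.from (evalₘ-true a oneₘ) λ _ _ _ → refl

  eval-wd : (a : Point r n) {p q : Poly r n} → p ≈ₚ q → eval a p ≡ eval a q
  eval-wd a {p} {q} = parity-wd (evalₘ a) (evalₘ-wd a) {p} {q}

  eval-* : (a : Point r n) (p q : Poly r n) → eval a (p *ₚ q) ≡ eval a p ∧ eval a q
  eval-* a p q = begin
    parity (evalₘ a) (p *ₚ q)                                 ≡⟨ parity-concatMap (evalₘ a) (λ μ → map (μ ·ₘ_) q) p ⟩
    parity (λ μ → parity (evalₘ a) (map (μ ·ₘ_) q)) p         ≡⟨ parity-cong monomial-times-q p ⟩
    parity (λ μ → evalₘ a μ ∧ eval a q) p                     ≡⟨ parity-∧ʳ (evalₘ a) (eval a q) p ⟩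
    eval a p ∧ eval a q                                       ∎
    where
    open ≡-Reasoning
    monomial-times-q : ∀ μ → parity (evalₘ a) (map (μ ·ₘ_) q) ≡ evalₘ a μ ∧ eval a q
    monomial-times-q μ = trans (parity-map (evalₘ a) (μ ·ₘ_) q)
      (trans (parity-cong (evalₘ-· a μ) q) (parity-∧ (evalₘ a μ) (evalₘ a) q))

  eval-x : (a : Point r n) → ∀ i j k → eval a (x i j k) ≡ a i j k
  eval-x a i j k = trans (xor-identityʳ _) (evalₘ-var a i j k)

  eval-1 : (a : Point r n) → eval a 1ₚ ≡ true
  eval-1 a = trans (xor-identityʳ _) (evalₘ-one a)

  eval-xx : (a : Point r n) → ∀ i j k i' j' k' → eval a (x i j k *ₚ x i' j' k') ≡ a i j k ∧ a i' j' k'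
  eval-xx a i j k i' j' k' = trans (eval-* a (x i j k) (x i' j' k')) (cong₂ _∧_ (eval-x a i j k) (eval-x a i' j' k'))

  eval-xxxx : (a : Point r n) → ∀ i j k l p q →
    eval a (((x i j p *ₚ x k l p) *ₚ x j i q) *ₚ x l k q) ≡ ((a i j p ∧ a k l p) ∧ a j i q) ∧ a l k q
  eval-xxxx a i j k l p q = trans (eval-* a ((x i j p *ₚ x k l p) *ₚ x j i q) (x l k q)) (cong₂ _∧_
    (trans (eval-* a (x i j p *ₚ x k l p) (x j i q)) (cong₂ _∧_ (eval-xx a i j p k l p) (eval-x a j i q))) (eval-x a l k q))

  combination : List (Poly r n × Poly r n) → Poly r n
  combination = foldr (λ hg acc → (proj₁ hg *ₚ proj₂ hg) +ₚ acc) 0ₚ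

  combination-++ : ∀ cs ds → combination (cs ++ ds) ≡ combination cs ++ combination ds
  combination-++ []             ds = refl
  combination-++ ((h , g) ∷ cs) ds =
    trans (cong ((h *ₚ g) ++_) (combination-++ cs ds)) (sym (++-assoc (h *ₚ g) (combination cs) (combination ds)))

  InI-wd : {p q : Poly r n} → p ≈ₚ q → InI q → InI p
  InI-wd p≈q (cs , gens , q≈) = cs , gens , λ m → trans (p≈q m) (q≈ m)

  InI-++ : {p q : Poly r n} → InI p → InI q → InI (p ++ q)
  InI-++ {p} {q} (cs , gs , p≈) (ds , hs , q≈) = cs ++ ds , AllP.++⁺ gs hs , λ m → begin
    coeff (p ++ q) m                                   ≡⟨ coeff-++ p q m ⟩
    coeff p m xor coeff q m                            ≡⟨ cong₂ _xor_ (p≈ m) (q≈ m) ⟩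
    coeff (combination cs) m xor coeff (combination ds) m ≡⟨ coeff-++ (combination cs) (combination ds) m ⟨
    coeff (combination cs ++ combination ds) m         ≡⟨ cong (λ f → coeff f m) (combination-++ cs ds) ⟨
    coeff (combination (cs ++ ds)) m                   ∎
    where open ≡-Reasoning

  InI-gen : {g : Poly r n} → IsGen r n g → (h : Poly r n) → InI (h *ₚ g)
  InI-gen {g} G h = (h , g) ∷ [] , G ∷ [] , λ m → cong (λ f → coeff f m) (sym (++-identityʳ (h *ₚ g)))

  ≈ₚ-∷ : {μ ν : Mon r n} {p q : Poly r n} → μ ≈ₘ ν → p ≈ₚ q → (μ ∷ p) ≈ₚ (ν ∷ q)
  ≈ₚ-∷ μ≈ν p≈q m = cong₂ (λ c b → if c then not b else b) (is-wd m μ≈ν) (p≈q m)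

  -- Congruence modulo I: over F₂ the difference p - q is p + q, i.e. p ++ q.
  record _≡ᴵ_ (p q : Poly r n) : Set where
    constructor mod-I
    field difference∈I : InI (p ++ q)
  open _≡ᴵ_ public

  ≈ₚ⇒≡ᴵ : {p q : Poly r n} → p ≈ₚ q → p ≡ᴵ q
  ≈ₚ⇒≡ᴵ {p} {q} p≈q = mod-I ([] , [] , λ m →
    trans (coeff-++ p q m) (trans (cong (coeff p m xor_) (sym (p≈q m))) (xor-same (coeff p m))))

  ≈ₘ⇒≡ᴵ : {μ ν : Mon r n} → μ ≈ₘ ν → (μ ∷ []) ≡ᴵ (ν ∷ [])
  ≈ₘ⇒≡ᴵ {μ} {ν} μ≈ν = ≈ₚ⇒≡ᴵ (≈ₚ-∷ {p = []} {q = []} μ≈ν λ _ → refl)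

  ≡ᴵ-sym : {p q : Poly r n} → p ≡ᴵ q → q ≡ᴵ p
  ≡ᴵ-sym {p} {q} (mod-I pq) = mod-I (InI-wd {q ++ p} {p ++ q} (λ m →
    trans (coeff-++ q p m) (trans (xor-comm (coeff q m) (coeff p m)) (sym (coeff-++ p q m)))) pq)

  ≡ᴵ-trans : {p q s : Poly r n} → p ≡ᴵ q → q ≡ᴵ s → p ≡ᴵ s
  ≡ᴵ-trans {p} {q} {s} (mod-I pq) (mod-I qs) =
    mod-I (InI-wd {p ++ s} {(p ++ q) ++ (q ++ s)} regroup (InI-++ {p ++ q} {q ++ s} pq qs))
    where
    regroup : (p ++ s) ≈ₚ ((p ++ q) ++ (q ++ s))
    regroup m rewrite coeff-++ p s m | coeff-++ (p ++ q) (q ++ s) m | coeff-++ p q m | coeff-++ q s m =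
      solve 3 (λ a b c → a :+ c := (a :+ b) :+ (b :+ c)) refl (coeff p m) (coeff q m) (coeff s m)

  ≡ᴵ-++ : {p p' q q' : Poly r n} → p ≡ᴵ p' → q ≡ᴵ q' → (p ++ q) ≡ᴵ (p' ++ q')
  ≡ᴵ-++ {p} {p'} {q} {q'} (mod-I pp') (mod-I qq') =
    mod-I (InI-wd {(p ++ q) ++ (p' ++ q')} {(p ++ p') ++ (q ++ q')} regroup (InI-++ {p ++ p'} {q ++ q'} pp' qq'))
    where
    regroup : ((p ++ q) ++ (p' ++ q')) ≈ₚ ((p ++ p') ++ (q ++ q'))
    regroup m rewrite coeff-++ (p ++ q) (p' ++ q') m | coeff-++ (p ++ p') (q ++ q') m
      | coeff-++ p q m | coeff-++ p' q' m | coeff-++ p p' m | coeff-++ q q' m =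
      solve 4 (λ a b c d → (a :+ b) :+ (c :+ d) := (a :+ c) :+ (b :+ d)) refl (coeff p m) (coeff q m) (coeff p' m) (coeff q' m)

  record Good (a : Point r n) : Set where
    field
      col  : ∀ i i' j k → i Fin.< i' → a i j k ∧ a i' j k ≡ false
      row  : ∀ i j j' k → j Fin.< j' → a i j k ∧ a i j' k ≡ false
      cell : ∀ i j k k' → k Fin.< k' → a i j k ∧ a i j k' ≡ false
      orth : ∀ i j k l p q → ¬ (i , j) ≡ (k , l) → ((a i j p ∧ a k l p) ∧ a j i q) ∧ a l k q ≡ false

  good⇒gen-vanishes : {a : Point r n} → Good a → ∀ {g} → IsGen r n g → eval a g ≡ false
  good⇒gen-vanishes {a} _ (g-bool i j k) = trans (trans (eval-* a (x i j k) (x i j k -ₚ 1ₚ))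
    (cong₂ _∧_ (eval-x a i j k) (trans (parity-++ (evalₘ a) (x i j k) 1ₚ) (cong₂ _xor_ (eval-x a i j k) (eval-1 a)))))
    (idempotent (a i j k))
    where
    idempotent : ∀ b → b ∧ (b xor true) ≡ false
    idempotent true  = refl
    idempotent false = refl
  good⇒gen-vanishes {a} G (g-col i i' j k lt)        = trans (eval-xx a i j k i' j k) (Good.col G i i' j k lt)
  good⇒gen-vanishes {a} G (g-row i j j' k lt)        = trans (eval-xx a i j k i j' k) (Good.row G i j j' k lt)
  good⇒gen-vanishes {a} G (g-cell i j k k' lt)       = trans (eval-xx a i j k i j k') (Good.cell G i j k k' lt)
  good⇒gen-vanishes {a} G (g-orth i j k l p q ne)    = trans (eval-xxxx a i j k l p q) (Good.orth G i j k l p q ne)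

  good⇒zero : {a : Point r n} → Good a → IsZeroOfI a
  good⇒zero {a} G f (cs , gens , f≈) = trans (eval-wd a {f} {combination cs} f≈) (vanishes cs gens)
    where
    vanishes : ∀ cs → All (λ hg → IsGen r n (proj₂ hg)) cs → eval a (combination cs) ≡ false
    vanishes []             []          = refl
    vanishes ((h , g) ∷ cs) (gen ∷ gens) = begin
      eval a ((h *ₚ g) ++ combination cs)           ≡⟨ parity-++ (evalₘ a) (h *ₚ g) (combination cs) ⟩
      eval a (h *ₚ g) xor eval a (combination cs)   ≡⟨ cong₂ _xor_ (eval-* a h g) (vanishes cs gens) ⟩
      (eval a h ∧ eval a g) xor false               ≡⟨ cong (λ c → (eval a h ∧ c) xor false) (good⇒gen-vanishes G gen) ⟩
      (eval a h ∧ false) xor false                  ≡⟨ cong (_xor false) (∧-zeroʳ (eval a h)) ⟩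
      false                                         ∎
      where open ≡-Reasoning

  zero⇒good : {a : Point r n} → IsZeroOfI a → Good a
  zero⇒good {a} Z = record
    { col  = λ i i' j k lt → trans (sym (eval-xx a i j k i' j k)) (vanishes (g-col i i' j k lt))
    ; row  = λ i j j' k lt → trans (sym (eval-xx a i j k i j' k)) (vanishes (g-row i j j' k lt))
    ; cell = λ i j k k' lt → trans (sym (eval-xx a i j k i j k')) (vanishes (g-cell i j k k' lt))
    ; orth = λ i j k l p q ne → trans (sym (eval-xxxx a i j k l p q)) (vanishes (g-orth i j k l p q ne))
    }
    where
    vanishes : ∀ {g} → IsGen r n g → eval a g ≡ false
    vanishes {g} G = trans (sym (trans (eval-* a 1ₚ g) (cong (_∧ eval a g) (eval-1 a)))) (Z (1ₚ *ₚ g) (InI-gen G 1ₚ))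

  _≤ₚ_ : Point r n → Point r n → Set
  a ≤ₚ b = ∀ i j k → a i j k ≡ true → b i j k ≡ true

  -- every constraint of Good is the vanishing of a product, so goodness is inherited downwards
  good-downward : {a b : Point r n} → a ≤ₚ b → Good b → Good a
  good-downward {a} {b} a≤b G = record
    { col  = λ i i' j k lt → below2 (a≤b i j k) (a≤b i' j k) (Good.col G i i' j k lt)
    ; row  = λ i j j' k lt → below2 (a≤b i j k) (a≤b i j' k) (Good.row G i j j' k lt)
    ; cell = λ i j k k' lt → below2 (a≤b i j k) (a≤b i j k') (Good.cell G i j k k' lt)
    ; orth = λ i j k l p q ne → below2 (above2 (above2 (a≤b i j p) (a≤b k l p)) (a≤b j i q)) (a≤b l k q) (Good.orth G i j k l p q ne)
    }
    where
    below2 : ∀ {u v u' v'} → (u ≡ true → u' ≡ true) → (v ≡ true → v' ≡ true) → u' ∧ v' ≡ false → u ∧ v ≡ false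
    below2 f g h = not-both λ u v → true-true-false h (f u) (g v)
    above2 : ∀ {u v u' v'} → (u ≡ true → u' ≡ true) → (v ≡ true → v' ≡ true) → u ∧ v ≡ true → u' ∧ v' ≡ true
    above2 {true} {true} f g _ = cong₂ _∧_ (f refl) (g refl)

by-order : ∀ {m} (R : Fin m → Fin m → Set) → (∀ {i i'} → i Fin.< i' → ¬ R i i') →
  (∀ {i i'} → R i i' → R i' i) → ∀ {i i'} → R i i' → i ≡ i'
by-order R below symm {i} {i'} rel with <-cmp i i'
... | tri< lt _ _ = ⊥-elim (below lt rel)
... | tri≈ _ eq _ = eq
... | tri> _ _ gt = ⊥-elim (below gt (symm rel))

cellCode : ∀ {n} → Maybe (Fin n) → Fin n → Bool
cellCode nothing  _ = false
cellCode (just s) k = does (s ≟ᶠ k)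

cellCode-self : ∀ {n} (s : Fin n) → cellCode (just s) s ≡ true
cellCode-self s with s ≟ᶠ s
... | yes _ = refl
... | no ne = ⊥-elim (ne refl)

cellCode-true : ∀ {n} (c : Maybe (Fin n)) k → cellCode c k ≡ true → c ≡ just k
cellCode-true (just s) k e with s ≟ᶠ k
... | yes refl = refl

module _ {r n : ℕ} where

  encode-cell : (P : Array r n) → ∀ i j k → encode P i j k ≡ cellCode (P i j) k
  encode-cell P i j k with P i j
  ... | nothing = refl
  ... | just s  = refl

  encode-true : (P : Array r n) → ∀ {i j k} → encode P i j k ≡ true → P i j ≡ just k
  encode-true P {i} {j} {k} e = cellCode-true (P i j) k (trans (sym (encode-cell P i j k)) e)

  encode-filled : (P : Array r n) → ∀ {i j k} → P i j ≡ just k → encode P i j k ≡ true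
  encode-filled P {i} {j} {k} e = trans (encode-cell P i j k) (trans (cong (λ c → cellCode c k) e) (cellCode-self k))

  encode-injective : (P Q : Array r n) → (∀ i j k → encode P i j k ≡ encode Q i j k) → P ≈ₐ Q
  encode-injective P Q e i j = cells (P i j) (Q i j) λ k →
    trans (sym (encode-cell P i j k)) (trans (e i j k) (encode-cell Q i j k))
    where
    cells : ∀ c c' → (∀ k → cellCode c k ≡ cellCode c' k) → c ≡ c'
    cells nothing  nothing  _ = refl
    cells nothing  (just t) h with () ← trans (h t) (cellCode-self t)
    cells (just s) c'       h = sym (cellCode-true c' s (trans (sym (h s)) (cellCode-self s)))

  sor⇒good : (P : Array r n) → IsSOR P → Good (encode P)
  sor⇒good P ((row , col) , orth) = record
    { col  = λ i i' j k lt → not-both λ e e' → <⇒≢ lt (col i i' j k (encode-true P e) (encode-true P e'))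
    ; row  = λ i j j' k lt → not-both λ e e' → <⇒≢ lt (row i j j' k (encode-true P e) (encode-true P e'))
    ; cell = λ i j k k' lt → not-both λ e e' → <⇒≢ lt (Maybe.just-injective (trans (sym (encode-true P e)) (encode-true P e')))
    ; orth = λ i j k l p q ne → not-all4 (encode P i j p) (encode P k l p) (encode P j i q) (encode P l k q)
        λ e₁ e₂ e₃ e₄ → ne (orth i j k l p q (encode-true P e₁) (encode-true P e₂) (encode-true P e₃) (encode-true P e₄))
    }
    where
    not-all4 : ∀ u v w z → (u ≡ true → v ≡ true → w ≡ true → z ≡ true → ⊥) → ((u ∧ v) ∧ w) ∧ z ≡ false
    not-all4 true true true true h = ⊥-elim (h refl refl refl refl)
    not-all4 true true true false _ = refl
    not-all4 true true false _ _ = refl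
    not-all4 true false _ _ _ = refl
    not-all4 false _ _ _ _ = refl

  good⇒sor : (P : Array r n) → Good (encode P) → IsSOR P
  good⇒sor P G = (row , col) , orth
    where
    row : ∀ i j j' s → P i j ≡ just s → P i j' ≡ just s → j ≡ j'
    row i j j' s e e' = by-order (λ j j' → encode P i j s ≡ true × encode P i j' s ≡ true)
      (λ {j} {j'} lt (u , v) → true-true-false (Good.row G i j j' s lt) u v) (λ (u , v) → v , u) (encode-filled P e , encode-filled P e')
    col : ∀ i i' j s → P i j ≡ just s → P i' j ≡ just s → i ≡ i'
    col i i' j s e e' = by-order (λ i i' → encode P i j s ≡ true × encode P i' j s ≡ true)
      (λ {i} {i'} lt (u , v) → true-true-false (Good.col G i i' j s lt) u v) (λ (u , v) → v , u) (encode-filled P e , encode-filled P e')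
    orth : Orthogonal P (transpose P)
    orth i j i' j' s t e₁ e₂ e₃ e₄ with ≡-dec _≟ᶠ_ _≟ᶠ_ (i , j) (i' , j')
    ... | yes eq = eq
    ... | no ne with () ← trans (sym (Good.orth G i j i' j' s t ne))
          (both (both (both (encode-filled P e₁) (encode-filled P e₂)) (encode-filled P e₃)) (encode-filled P e₄))

symbolOf : ∀ {n} {P : Fin n → Set} → Dec (∃ P) → Maybe (Fin n)
symbolOf (yes (k , _)) = just k
symbolOf (no _)        = nothing

module _ {r n : ℕ} where

  decode : Point r n → Array r n
  decode a i j = symbolOf (any? λ k → a i j k ≟ᵇ true)

  -- on good points each cell carries at most one symbol, so decoding inverts encoding
  encode-decode : {a : Point r n} → Good a → ∀ i j k → encode (decode a) i j k ≡ a i j k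
  encode-decode {a} G i j k = trans (encode-cell (decode a) i j k) (cell (any? λ k → a i j k ≟ᵇ true))
    where
    unique : ∀ {s t} → a i j s ≡ true → a i j t ≡ true → s ≡ t
    unique as at = by-order (λ s t → a i j s ≡ true × a i j t ≡ true)
      (λ {s} {t} lt (u , v) → true-true-false (Good.cell G i j s t lt) u v) (λ (u , v) → v , u) (as , at)
    cell : (d : Dec (∃ λ k → a i j k ≡ true)) → cellCode (symbolOf d) k ≡ a i j k
    cell (yes (s , as)) = ⇔→≡ {cellCode (just s) k} {a i j k} {true} (mk⇔
      (λ e → subst (λ t → a i j t ≡ true) (Maybe.just-injective (cellCode-true (just s) k e)) as)
      (λ ak → subst (λ t → cellCode (just s) t ≡ true) (unique as ak) (cellCode-self s)))
    cell (no none) = sym (¬true⇒false λ ak → none (k , ak))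

  decode-sor : {a : Point r n} → Good a → IsSOR (decode a)
  decode-sor {a} G = good⇒sor (decode a) (good-downward (λ i j k e → trans (sym (encode-decode G i j k)) e) G)

  Violated : Point r n → Set
  Violated a = Σ (Mon r n) λ g → IsGen r n (g ∷ []) × evalₘ a g ≡ true

  violation : {a : Point r n} {g : Mon r n} → IsGen r n (g ∷ []) → eval a (g ∷ []) ≡ true → Violated a
  violation {a} {g} gen e = g , gen , trans (sym (xor-identityʳ (evalₘ a g))) e

  good-or-violated : (a : Point r n) → Good a ⊎ Violated a
  good-or-violated a
    with any? (λ i → any? λ i' → any? λ j → any? λ k → (i <? i') ×-dec (a i j k ∧ a i' j k ≟ᵇ true))
  ... | yes (i , i' , j , k , lt , e) = inj₂ (violation (g-col i i' j k lt) (trans (eval-xx a i j k i' j k) e))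
  ... | no no-col
    with any? (λ i → any? λ j → any? λ j' → any? λ k → (j <? j') ×-dec (a i j k ∧ a i j' k ≟ᵇ true))
  ... | yes (i , j , j' , k , lt , e) = inj₂ (violation (g-row i j j' k lt) (trans (eval-xx a i j k i j' k) e))
  ... | no no-row
    with any? (λ i → any? λ j → any? λ k → any? λ k' → (k <? k') ×-dec (a i j k ∧ a i j k' ≟ᵇ true))
  ... | yes (i , j , k , k' , lt , e) = inj₂ (violation (g-cell i j k k' lt) (trans (eval-xx a i j k i j k') e))
  ... | no no-cell
    with any? (λ i → any? λ j → any? λ k → any? λ l → any? λ p → any? λ q →
           ¬? (≡-dec _≟ᶠ_ _≟ᶠ_ (i , j) (k , l)) ×-dec (((a i j p ∧ a k l p) ∧ a j i q) ∧ a l k q ≟ᵇ true))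
  ... | yes (i , j , k , l , p , q , ne , e) = inj₂ (violation (g-orth i j k l p q ne) (trans (eval-xxxx a i j k l p q) e))
  ... | no no-orth = inj₁ record
    { col  = λ i i' j k lt → ¬true⇒false λ e → no-col (i , i' , j , k , lt , e)
    ; row  = λ i j j' k lt → ¬true⇒false λ e → no-row (i , j , j' , k , lt , e)
    ; cell = λ i j k k' lt → ¬true⇒false λ e → no-cell (i , j , k , k' , lt , e)
    ; orth = λ i j k l p q ne → ¬true⇒false λ e → no-orth (i , j , k , l , p , q , ne , e)
    }

positive : ℕ → Bool
positive zero    = false
positive (suc _) = true

bit : Bool → ℕ
bit b = if b then 1 else 0

small-exponent : ∀ e → e ≤ 1 → bit (positive e) ≡ e
small-exponent zero          _         = refl
small-exponent (suc zero)    _         = refl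
small-exponent (suc (suc _)) (s≤s ())

capped : ∀ e → bit (positive e) ≤ 1
capped zero    = z≤n
capped (suc _) = s≤s z≤n

positive-bit : ∀ e → positive (bit (positive e)) ≡ positive e
positive-bit zero    = refl
positive-bit (suc _) = refl

module _ {r n : ℕ} where

  supp : Mon r n → Point r n
  supp μ i j k = positive (μ i j k)

  monOf : Point r n → Mon r n
  monOf a i j k = bit (a i j k)

  supp-monOf : (a : Point r n) → ∀ i j k → supp (monOf a) i j k ≡ a i j k
  supp-monOf a i j k with a i j k
  ... | true  = refl
  ... | false = refl

  monOf-wd : {a b : Point r n} → (∀ i j k → a i j k ≡ b i j k) → monOf a ≈ₘ monOf b
  monOf-wd e i j k = cong bit (e i j k)

  setAt : Mon r n → Var → ℕ → Mon r n
  setAt μ v e i j k = if does (v ≟ᵥ (i , j , k)) then e else μ i j k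

  setAt-here : ∀ μ v e → setAt μ v e ⟨ v ⟩ ≡ e
  setAt-here μ v@(i , j , k) e = decide-var v v (λ c → (if c then e else μ i j k) ≡ e) (λ _ → refl) (λ ne → ⊥-elim (ne refl))

  setAt-there : ∀ μ v e w → ¬ v ≡ w → setAt μ v e ⟨ w ⟩ ≡ μ ⟨ w ⟩
  setAt-there μ v e w@(i , j , k) v≢w = decide-var v w (λ c → (if c then e else μ i j k) ≡ μ i j k) (λ v≡w → ⊥-elim (v≢w v≡w)) (λ _ → refl)

  -- an exponent ≥ 2 drops by one modulo I: w·x_v² ≡ w·x_v via the generator x_v(x_v - 1)
  lower-exponent : ∀ μ v e → μ ⟨ v ⟩ ≡ suc (suc e) → (μ ∷ []) ≡ᴵ (setAt μ v (suc e) ∷ [])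
  lower-exponent μ v@(i₀ , j₀ , k₀) e μv≡ =
    mod-I (InI-wd {p = μ ∷ ν ∷ []} {q = w ·ₘ (xv ·ₘ xv) ∷ w ·ₘ (xv ·ₘ oneₘ) ∷ []}
      (≈ₚ-∷ {p = ν ∷ []} {q = w ·ₘ (xv ·ₘ oneₘ) ∷ []} μ≈ (≈ₚ-∷ {p = []} {q = []} ν≈ λ _ → refl))
      (InI-gen (g-bool i₀ j₀ k₀) (w ∷ [])))
    where
    w = setAt μ v e
    ν = setAt μ v (suc e)
    xv = varₘ i₀ j₀ k₀
    μ≈ : μ ≈ₘ (w ·ₘ (xv ·ₘ xv))
    μ≈ i j k = decide-var v (i , j , k) (λ c → μ i j k ≡ (if c then e else μ i j k) + (bit c + bit c))
      (λ { refl → trans μv≡ (+-comm 2 e) }) (λ _ → sym (+-identityʳ _))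
    ν≈ : ν ≈ₘ (w ·ₘ (xv ·ₘ oneₘ))
    ν≈ i j k = decide-var v (i , j , k) (λ c → (if c then suc e else μ i j k) ≡ (if c then e else μ i j k) + (bit c + 0))
      (λ _ → +-comm 1 e) (λ _ → sym (+-identityʳ _))

  capAt : Var → Mon r n → Mon r n
  capAt v μ = setAt μ v (bit (positive (μ ⟨ v ⟩)))

  unchanged : ∀ μ v {e} → μ ⟨ v ⟩ ≡ e → bit (positive e) ≡ e → μ ≈ₘ capAt v μ
  unchanged μ v μv≡ capped i j k with v ≟ᵥ (i , j , k)
  ... | yes refl = sym (trans (setAt-here μ v _) (trans (cong (bit ∘′ positive) μv≡) (trans capped (sym μv≡))))
  ... | no v≢w = sym (setAt-there μ v _ (i , j , k) v≢w)

  cap-variable : ∀ e μ v → μ ⟨ v ⟩ ≡ e → (μ ∷ []) ≡ᴵ (capAt v μ ∷ [])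
  cap-variable zero          μ v μv≡ = ≈ₘ⇒≡ᴵ (unchanged μ v μv≡ refl)
  cap-variable (suc zero)    μ v μv≡ = ≈ₘ⇒≡ᴵ (unchanged μ v μv≡ refl)
  cap-variable (suc (suc e)) μ v μv≡ =
    ≡ᴵ-trans (lower-exponent μ v e μv≡)
      (≡ᴵ-trans (cap-variable (suc e) ν v (setAt-here μ v (suc e))) (≈ₘ⇒≡ᴵ same-cap))
    where
    ν = setAt μ v (suc e)
    same-cap : capAt v ν ≈ₘ capAt v μ
    same-cap i j k with v ≟ᵥ (i , j , k)
    ... | yes refl = trans (setAt-here ν v _) (trans (cong (bit ∘′ positive) (setAt-here μ v (suc e)))
                       (trans (cong (bit ∘′ positive) (sym μv≡)) (sym (setAt-here μ v _))))
    ... | no v≢w = trans (setAt-there ν v _ (i , j , k) v≢w) (trans (setAt-there μ v _ (i , j , k) v≢w)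
                     (sym (setAt-there μ v _ (i , j , k) v≢w)))


  squarefree-on : ∀ vs μ → (∀ w → ¬ w ∈ vs → μ ⟨ w ⟩ ≤ 1) → (μ ∷ []) ≡ᴵ (monOf (supp μ) ∷ [])
  squarefree-on []       μ small = ≈ₘ⇒≡ᴵ λ i j k → sym (small-exponent (μ i j k) (small (i , j , k) λ ()))
  squarefree-on (v ∷ vs) μ small =
    ≡ᴵ-trans (cap-variable _ μ v refl) (≡ᴵ-trans (squarefree-on vs (capAt v μ) small') (≈ₘ⇒≡ᴵ (monOf-wd same-supp)))
    where
    small' : ∀ w → ¬ w ∈ vs → capAt v μ ⟨ w ⟩ ≤ 1
    small' w w∉vs with v ≟ᵥ w
    ... | yes refl = subst (_≤ 1) (sym (setAt-here μ v _)) (capped (μ ⟨ v ⟩))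
    ... | no v≢w  = subst (_≤ 1) (sym (setAt-there μ v _ w v≢w))
                      (small w λ { (here w≡v) → v≢w (sym w≡v) ; (there w∈vs) → w∉vs w∈vs })
    same-supp : ∀ i j k → supp (capAt v μ) i j k ≡ supp μ i j k
    same-supp i j k with v ≟ᵥ (i , j , k)
    ... | yes refl = trans (cong positive (setAt-here μ v _)) (positive-bit (μ ⟨ v ⟩))
    ... | no v≢w  = cong positive (setAt-there μ v _ (i , j , k) v≢w)

  squarefree-reduction : ∀ μ → (μ ∷ []) ≡ᴵ (monOf (supp μ) ∷ [])
  squarefree-reduction μ = squarefree-on vars μ λ w w∉vars → ⊥-elim (w∉vars (∈-vars w))

  -- If the support of μ violates a monomial generator g, then μ ∈ I:
  -- μ ≡ x^{supp μ} = x^{supp (μ g)} ≡ μ g ∈ I.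
  violated⇒InI : ∀ μ → Violated (supp μ) → InI (μ ∷ [])
  violated⇒InI μ (g , gen , g-on-supp) = difference∈I
    (≡ᴵ-trans (squarefree-reduction μ) (≡ᴵ-trans (≈ₘ⇒≡ᴵ (monOf-wd same-supp))
      (≡ᴵ-trans (≡ᴵ-sym (squarefree-reduction (μ ·ₘ g))) μg∈I)))
    where
    μg∈I : ((μ ·ₘ g) ∷ []) ≡ᴵ []
    μg∈I = mod-I (InI-gen gen (μ ∷ []))
    absorb : ∀ e f → pow (positive e) f ≡ true → positive (e + f) ≡ positive e
    absorb zero    zero _ = refl
    absorb (suc e) f    _ = refl
    same-supp : ∀ i j k → supp μ i j k ≡ supp (μ ·ₘ g) i j k
    same-supp i j k = sym (absorb (μ i j k) (g i j k) (Equivalence.to (evalₘ-true (supp μ) g) g-on-supp i j k))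

pow-true : ∀ e → pow true e ≡ true
pow-true zero    = refl
pow-true (suc e) = pow-true e

pow-char : ∀ b e → pow b e ≡ true ⇔ (positive e ≡ true → b ≡ true)
pow-char b     zero    = mk⇔ (λ _ ()) (λ _ → refl)
pow-char true  (suc e) = mk⇔ (λ _ _ → refl) (λ _ → pow-true e)
pow-char false (suc e) = mk⇔ (λ ()) (λ h → h refl)

module _ {r n : ℕ} where

  evalₘ-supp : (a : Point r n) (μ : Mon r n) → evalₘ a μ ≡ true ⇔ supp μ ≤ₚ a
  evalₘ-supp a μ = mk⇔
    (λ e i j k → Equivalence.to (pow-char (a i j k) (μ i j k)) (Equivalence.to (evalₘ-true a μ) e i j k))
    (λ h → Equivalence.from (evalₘ-true a μ) λ i j k → Equivalence.from (pow-char (a i j k) (μ i j k)) (h i j k))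

  _≐_ : Point r n → Point r n → Set
  a ≐ b = ∀ i j k → a i j k ≡ b i j k

  _≐?_ : (a b : Point r n) → Dec (a ≐ b)
  a ≐? b = all? λ i → all? λ j → all? λ k → a i j k ≟ᵇ b i j k

  exactly : Point r n → Mon r n → Bool
  exactly b μ = does (supp μ ≐? b)

  exactly-wd : (b : Point r n) → WellDefined (exactly b)
  exactly-wd b {μ} {ν} μ≈ν = does-cong
    (λ e i j k → trans (cong positive (sym (μ≈ν i j k))) (e i j k))
    (λ e i j k → trans (cong positive (μ≈ν i j k)) (e i j k)) (supp μ ≐? b) (supp ν ≐? b)

  clear : Var → Point r n → Point r n
  clear v b i j k = if does (v ≟ᵥ (i , j , k)) then false else b i j k

  clear-here : ∀ v b → clear v b ⟨ v ⟩ ≡ false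
  clear-here v@(i , j , k) b = decide-var v v (λ c → (if c then false else b i j k) ≡ false) (λ _ → refl) (λ ne → ⊥-elim (ne refl))

  clear-there : ∀ v b w → ¬ v ≡ w → clear v b ⟨ w ⟩ ≡ b ⟨ w ⟩
  clear-there v b w@(i , j , k) v≢w = decide-var v w (λ c → (if c then false else b i j k) ≡ b i j k) (λ v≡w → ⊥-elim (v≢w v≡w)) (λ _ → refl)

  clear-≤ : ∀ v b → clear v b ≤ₚ b
  clear-≤ v b i j k e with v ≟ᵥ (i , j , k)
  ... | yes refl with () ← trans (sym e) (clear-here v b)
  ... | no v≢w = trans (sym (clear-there v b (i , j , k) v≢w)) e

  -- Σ_a F(a) over F₂, where a ≤ b ranges over the points agreeing with b outside vs
  subsetSum : List Var → Point r n → (Point r n → Bool) → Bool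
  subsetSum []       b F = F b
  subsetSum (v ∷ vs) b F = subsetSum vs b F xor (b ⟨ v ⟩ ∧ subsetSum vs (clear v b) F)

  subsetSum-vanishes : ∀ vs b F → (∀ a → a ≤ₚ b → F a ≡ false) → subsetSum vs b F ≡ false
  subsetSum-vanishes []       b F h = h b λ _ _ _ e → e
  subsetSum-vanishes (v ∷ vs) b F h
    rewrite subsetSum-vanishes vs b F h
          | subsetSum-vanishes vs (clear v b) F (λ a a≤ → h a λ i j k e → clear-≤ v b i j k (a≤ i j k e))
    = ∧-zeroʳ (b ⟨ v ⟩)

  subsetSum-xor : ∀ vs b F G → subsetSum vs b (λ a → F a xor G a) ≡ subsetSum vs b F xor subsetSum vs b G
  subsetSum-xor []       b F G = refl
  subsetSum-xor (v ∷ vs) b F G rewrite subsetSum-xor vs b F G | subsetSum-xor vs (clear v b) F G =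
    solve 5 (λ x y c u w → (x :+ y) :+ (c :* (u :+ w)) := (x :+ (c :* u)) :+ (y :+ (c :* w))) refl (subsetSum vs b F) (subsetSum vs b G) (b ⟨ v ⟩) (subsetSum vs (clear v b) F) (subsetSum vs (clear v b) G)

  subsetSum-eval : ∀ vs b (f : Poly r n) →
    subsetSum vs b (λ a → eval a f) ≡ parity (λ μ → subsetSum vs b (λ a → evalₘ a μ)) f
  subsetSum-eval vs b []      = subsetSum-vanishes vs b (λ _ → false) (λ _ _ → refl)
  subsetSum-eval vs b (μ ∷ f) =
    trans (subsetSum-xor vs b (λ a → evalₘ a μ) (λ a → eval a f)) (cong (subsetSum vs b (λ a → evalₘ a μ) xor_) (subsetSum-eval vs b f))

  covers : Point r n → Mon r n → Var → Bool
  covers b μ v = not (b ⟨ v ⟩ ∧ not (positive (μ ⟨ v ⟩)))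

  evalₘ-clear : ∀ v b μ → evalₘ (clear v b) μ ≡ evalₘ b μ ∧ not (positive (μ ⟨ v ⟩))
  evalₘ-clear v b μ = ⇔→≡ {z = true} (mk⇔ to from)
    where
    to : evalₘ (clear v b) μ ≡ true → evalₘ b μ ∧ not (positive (μ ⟨ v ⟩)) ≡ true
    to e with positive (μ ⟨ v ⟩) in pv
    ... | true with () ← trans (sym (Equivalence.to (evalₘ-supp (clear v b) μ) e _ _ _ pv)) (clear-here v b)
    ... | false = trans (∧-identityʳ _) (Equivalence.from (evalₘ-supp b μ) λ i j k p →
                    clear-≤ v b i j k (Equivalence.to (evalₘ-supp (clear v b) μ) e i j k p))
    from : evalₘ b μ ∧ not (positive (μ ⟨ v ⟩)) ≡ true → evalₘ (clear v b) μ ≡ true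
    from e with evalₘ b μ in eb | positive (μ ⟨ v ⟩) in pv
    ... | true | false = Equivalence.from (evalₘ-supp (clear v b) μ) λ i j k p → inside i j k p
      where
      inside : ∀ i j k → positive (μ i j k) ≡ true → clear v b i j k ≡ true
      inside i j k p with v ≟ᵥ (i , j , k)
      ... | yes refl with () ← trans (sym pv) p
      ... | no v≢w = trans (clear-there v b (i , j , k) v≢w) (Equivalence.to (evalₘ-supp b μ) eb i j k p)

  subsetSum-monomial : ∀ vs b μ → Unique vs →
    subsetSum vs b (λ a → evalₘ a μ) ≡ evalₘ b μ ∧ and (map (covers b μ) vs)
  subsetSum-monomial []       b μ []                = sym (∧-identityʳ _)
  subsetSum-monomial (v ∷ vs) b μ (v∉vs ∷ distinct) = begin
    S b xor (b ⟨ v ⟩ ∧ S (clear v b))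
      ≡⟨ cong₂ (λ s s' → s xor (b ⟨ v ⟩ ∧ s')) (subsetSum-monomial vs b μ distinct) (subsetSum-monomial vs (clear v b) μ distinct) ⟩
    (E ∧ A) xor (b ⟨ v ⟩ ∧ (evalₘ (clear v b) μ ∧ and (map (covers (clear v b) μ) vs)))
      ≡⟨ cong₂ (λ e a → (E ∧ A) xor (b ⟨ v ⟩ ∧ (e ∧ a))) (evalₘ-clear v b μ) (cong and same-covers) ⟩
    (E ∧ A) xor (b ⟨ v ⟩ ∧ ((E ∧ not p) ∧ A))
      ≡⟨ solve 4 (λ e a c q → (e :* a) :+ (c :* ((e :* q) :* a)) := (e :* a) :+ ((c :* q) :* (e :* a))) refl E A (b ⟨ v ⟩) (not p) ⟩
    (E ∧ A) xor ((b ⟨ v ⟩ ∧ not p) ∧ (E ∧ A))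
      ≡⟨ absorb (b ⟨ v ⟩ ∧ not p) (E ∧ A) ⟩
    not (b ⟨ v ⟩ ∧ not p) ∧ (E ∧ A)
      ≡⟨ solve 3 (λ d e a → d :* (e :* a) := e :* (d :* a)) refl (not (b ⟨ v ⟩ ∧ not p)) E A ⟩
    E ∧ (covers b μ v ∧ A) ∎
    where
    open ≡-Reasoning
    S = λ b' → subsetSum vs b' (λ a → evalₘ a μ)
    E = evalₘ b μ
    A = and (map (covers b μ) vs)
    p = positive (μ ⟨ v ⟩)
    absorb : ∀ c y → y xor (c ∧ y) ≡ not c ∧ y
    absorb true  y = xor-same y
    absorb false y = xor-identityʳ y
    same-covers : map (covers (clear v b) μ) vs ≡ map (covers b μ) vs
    same-covers = map-cong-local (All.map (λ v≢w → cong (λ c → not (c ∧ not (positive (μ ⟨ _ ⟩)))) (clear-there v b _ v≢w)) v∉vs)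

module _ {r n : ℕ} where

  distinctVars : List (Var {r} {n})
  distinctVars = deduplicate _≟ᵥ_ vars

  covers-true : ∀ b (μ : Mon r n) v → covers b μ v ≡ true ⇔ (b ⟨ v ⟩ ≡ true → positive (μ ⟨ v ⟩) ≡ true)
  covers-true b μ v with b ⟨ v ⟩ | positive (μ ⟨ v ⟩)
  ... | true  | true  = mk⇔ (λ _ _ → refl) (λ _ → refl)
  ... | true  | false = mk⇔ (λ ()) (λ h → h refl)
  ... | false | _     = mk⇔ (λ _ ()) (λ _ → refl)

  -- Möbius inversion over F₂: summing evalₘ · μ over the points below b
  -- detects whether the support of μ is exactly b.
  exactly-subsetSum : ∀ b (μ : Mon r n) → subsetSum distinctVars b (λ a → evalₘ a μ) ≡ exactly b μ
  exactly-subsetSum b μ = trans (subsetSum-monomial distinctVars b μ (UniqueProp.deduplicate-! _≟ᵥ_ vars))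
    (⇔→≡ {z = true} (mk⇔ to (λ e → from (does-true (supp μ ≐? b) e))))
    where
    supp-≤ : evalₘ b μ ≡ true → supp μ ≤ₚ b
    supp-≤ = Equivalence.to (evalₘ-supp b μ)
    covered : and (map (covers b μ) distinctVars) ≡ true → ∀ i j k → b i j k ≡ true → positive (μ i j k) ≡ true
    covered e i j k = Equivalence.to (covers-true b μ (i , j , k))
      (and-map⁻ (covers b μ) e (∈-deduplicate⁺ _≟ᵥ_ (∈-vars (i , j , k))))
    to : evalₘ b μ ∧ and (map (covers b μ) distinctVars) ≡ true → exactly b μ ≡ true
    to e with evalₘ b μ in eb
    ... | true = dec-true (supp μ ≐? b) λ i j k →
      ⇔→≡ {z = true} (mk⇔ (supp-≤ eb i j k) (covered e i j k))
    from : supp μ ≐ b → evalₘ b μ ∧ and (map (covers b μ) distinctVars) ≡ true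
    from s = cong₂ _∧_ (Equivalence.from (evalₘ-supp b μ) λ i j k p → trans (sym (s i j k)) p)
      (and-map⁺ (covers b μ) (λ v → Equivalence.from (covers-true b μ v) λ bv → trans (s _ _ _) bv) distinctVars)

  -- Key lemma.  For a good point b the linear functional
  --   f ↦ #{monomials of f with support exactly b} mod 2
  -- vanishes on I: it equals Σ_{a ≤ b} eval a f, and every a ≤ b is a zero of I.
  exactly-annihilates-I : {b : Point r n} → Good b → ∀ f → InI f → parity (exactly b) f ≡ false
  exactly-annihilates-I {b} G f f∈I = begin
    parity (exactly b) f                                              ≡⟨ parity-cong (λ μ → sym (exactly-subsetSum b μ)) f ⟩
    parity (λ μ → subsetSum distinctVars b (λ a → evalₘ a μ)) f       ≡⟨ subsetSum-eval distinctVars b f ⟨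
    subsetSum distinctVars b (λ a → eval a f)                         ≡⟨ subsetSum-vanishes distinctVars b (λ a → eval a f)
                                                                           (λ a a≤b → good⇒zero (good-downward a≤b G) f f∈I) ⟩
    false                                                             ∎
    where open ≡-Reasoning

lex-irrefl : ∀ {xs} → ¬ LexLt xs xs
lex-irrefl (here a<a) = <-irrefl′ a<a
  where
  <-irrefl′ : ∀ {a} → ¬ a < a
  <-irrefl′ (s≤s a<a) = <-irrefl′ a<a
lex-irrefl (there l) = lex-irrefl l

bit-positive-≤ : ∀ e → bit (positive e) ≤ e
bit-positive-≤ zero    = z≤n
bit-positive-≤ (suc e) = s≤s z≤n

divides-bit : ∀ e d c → e + d ≡ bit c → d ≤ 1 × (positive d ≡ true → c ≡ true)
divides-bit e zero    c     _  = z≤n , λ ()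
divides-bit e (suc d) true  eq = ≤-trans (m≤n+m (suc d) e) (≤-reflexive eq) , λ _ → refl
divides-bit e (suc d) false eq = ⊥-elim (1+n≢0 (trans (sym (+-suc e d)) eq))

bit-below : ∀ d e → d ≤ 1 → (positive d ≡ true → positive e ≡ true) → d ≤ e
bit-below zero          _       _        _ = z≤n
bit-below (suc zero)    zero    _        h with () ← h refl
bit-below (suc zero)    (suc e) _        _ = s≤s z≤n
bit-below (suc (suc _)) _       (s≤s ()) _

module _ {r n : ℕ} where

  basisMon : Array r n → Mon r n
  basisMon P = monOf (encode P)

  flat-wd : {μ ν : Mon r n} → μ ≈ₘ ν → flat μ ≡ flat ν
  flat-wd = T3-cong

  lex-below : {μ ν : Mon r n} → (∀ i j k → μ i j k ≤ ν i j k) → ∀ {i j k} → μ i j k < ν i j k → LexLt (flat μ) (flat ν)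
  lex-below {μ} {ν} μ≤ν {i} {j} {k} lt = subst₂ LexLt (sym (T3-vars μ)) (sym (T3-vars ν))
    (lex-map (μ ⟨_⟩) (ν ⟨_⟩) (λ { (i , j , k) → μ≤ν i j k }) (∈-vars (i , j , k)) lt)

  not-lex-below : {μ ν : Mon r n} → (∀ i j k → ν i j k ≤ μ i j k) → ¬ LexLt (flat μ) (flat ν)
  not-lex-below {μ} {ν} ν≤μ l = no-lex-map (μ ⟨_⟩) (ν ⟨_⟩) (λ { (i , j , k) → ν≤μ i j k }) vars
    (subst₂ LexLt (T3-vars μ) (T3-vars ν) l)

  is-true : ∀ (m μ : Mon r n) → is m μ ≡ true → μ ≈ₘ m
  is-true m μ = does-true (μ ≈ₘ? m)

  coeff-single : ∀ (μ m : Mon r n) → coeff (μ ∷ []) m ≡ is m μ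
  coeff-single μ m = trans (coeff-parity (μ ∷ []) m) (xor-identityʳ (is m μ))

  coeff-pair : ∀ (μ ν m : Mon r n) → coeff (μ ∷ ν ∷ []) m ≡ is m μ xor is m ν
  coeff-pair μ ν m = trans (coeff-parity (μ ∷ ν ∷ []) m) (cong (is m μ xor_) (xor-identityʳ (is m ν)))

  lead-single : (μ : Mon r n) → IsLeadMon (μ ∷ []) μ
  lead-single μ = trans (coeff-single μ μ) (is-self μ) ,
    λ m c → inj₂ (≈ₘ-sym (is-true m μ (trans (sym (coeff-single μ m)) c)))

  lead-pair : (μ ν : Mon r n) → LexLt (flat ν) (flat μ) → IsLeadMon (μ ∷ ν ∷ []) μ
  lead-pair μ ν ν<μ = trans (coeff-pair μ ν μ) (cong₂ _xor_ (is-self μ) ν-not-μ) , other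
    where
    ν-not-μ : is μ ν ≡ false
    ν-not-μ = ¬true⇒false λ e → lex-irrefl (subst (λ l → LexLt l (flat μ)) (flat-wd (is-true μ ν e)) ν<μ)
    other : ∀ m → coeff (μ ∷ ν ∷ []) m ≡ true → m ≤lex μ
    other m c with is m μ in μm | is m ν in νm
    ... | true  | _    = inj₂ (≈ₘ-sym (is-true m μ μm))
    ... | false | true = inj₁ (subst (λ l → LexLt l (flat μ)) (flat-wd (is-true m ν νm)) ν<μ)
    ... | false | false with () ← c

  violated⇒initial : (μ : Mon r n) → Violated (supp μ) → InInitial μ
  violated⇒initial μ v = μ ∷ [] , violated⇒InI μ v , μ , lead-single μ , oneₘ , λ _ _ _ → refl

  exponent≥2⇒initial : (μ : Mon r n) → ∀ {i j k e} → μ i j k ≡ suc (suc e) → InInitial μ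
  exponent≥2⇒initial μ {i} {j} {k} eq =
    μ ∷ monOf (supp μ) ∷ [] , difference∈I (squarefree-reduction μ) , μ , lead-pair μ (monOf (supp μ)) smaller , oneₘ , λ _ _ _ → refl
    where
    smaller : LexLt (flat (monOf (supp μ))) (flat μ)
    smaller = lex-below (λ i j k → bit-positive-≤ (μ i j k)) (subst (λ e → bit (positive e) < e) (sym eq) (s≤s (s≤s z≤n)))

  standard⇒basis : (μ : Mon r n) → ¬ InInitial μ → Σ (Array r n) λ P → IsSOR P × μ ≈ₘ basisMon P
  standard⇒basis μ standard with good-or-violated (supp μ)
  ... | inj₂ v = ⊥-elim (standard (violated⇒initial μ v))
  ... | inj₁ G = decode (supp μ) , decode-sor G , λ i j k →
        trans (sym (small-exponent (μ i j k) (small i j k))) (cong bit (sym (encode-decode {a = supp μ} G i j k)))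
    where
    small : ∀ i j k → μ i j k ≤ 1
    small i j k with μ i j k in eq
    ... | zero          = z≤n
    ... | suc zero      = s≤s z≤n
    ... | suc (suc e)   = ⊥-elim (standard (exponent≥2⇒initial μ eq))

  lead-detected : (G : Mon r n → Bool) → WellDefined G → ∀ {f m} → IsLeadMon f m → G m ≡ true →
    (∀ μ → LexLt (flat μ) (flat m) → G μ ≡ false) → parity G f ≡ true
  lead-detected G G-wd {f} {m} (m∈f , m-lead) Gm below = begin
    parity G f                                    ≡⟨ parity-split G G-wd m f ⟩
    (coeff f m ∧ G m) xor parity G (remove m f)   ≡⟨ cong₂ (λ c g → (c ∧ g) xor parity G (remove m f)) m∈f Gm ⟩
    true xor parity G (remove m f)                ≡⟨ cong (true xor_) (parity-vanishes G G-wd (remove m f) rest) ⟩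
    true                                          ∎
    where
    open ≡-Reasoning
    rest : ∀ μ → coeff (remove m f) μ ≡ true → G μ ≡ false
    rest μ c = compare (m-lead μ (∧-true⇒ʳ c'))
      where
      c' : not (is m μ) ∧ coeff f μ ≡ true
      c' = trans (sym (coeff-remove m f μ)) c
      compare : μ ≤lex m → G μ ≡ false
      compare (inj₁ μ<m) = below μ μ<m
      compare (inj₂ μ≈m) with () ← trans (sym c') (cong (λ t → not t ∧ coeff f μ) (dec-true (μ ≈ₘ? m) μ≈m))

  -- Conversely every basis monomial is standard: if x^{encode P} = u·lm(f) with f ∈ I,
  -- then b = supp (lm f) is good, and the functional "support exactly b" is 1 on lm f
  -- and 0 on lex-smaller monomials, so it is 1 on f, contradicting the key lemma.
  basis-standard : (P : Array r n) → IsSOR P → ¬ InInitial (basisMon P)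
  basis-standard P sor (f , f∈I , m , m-lead , u , u·m≈) =
    true≢false (trans (sym (lead-detected (exactly b) (exactly-wd b) {f} {m} m-lead m-exactly below))
                      (exactly-annihilates-I G f f∈I))
    where
    b = supp m
    factor : ∀ i j k → m i j k ≤ 1 × (positive (m i j k) ≡ true → encode P i j k ≡ true)
    factor i j k = divides-bit (u i j k) (m i j k) (encode P i j k) (u·m≈ i j k)
    G : Good b
    G = good-downward (λ i j k → proj₂ (factor i j k)) (sor⇒good P sor)
    m-exactly : exactly b m ≡ true
    m-exactly = dec-true (supp m ≐? b) λ _ _ _ → refl
    -- a monomial with support b lies pointwise above the 0/1-vector m, so not lex-below it
    below : ∀ μ → LexLt (flat μ) (flat m) → exactly b μ ≡ false
    below μ μ<m = ¬true⇒false λ e → not-lex-below (λ i j k → bit-below (m i j k) (μ i j k) (proj₁ (factor i j k))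
      (λ p → trans (does-true (supp μ ≐? b) e i j k) p)) μ<m

unit : ∀ {d} → Fin d → Vec Bool d
unit {suc d} Fin.zero = true Vec.∷ replicate d false
unit (Fin.suc k)      = false Vec.∷ unit k

all-false : ∀ {d} (cs : Vec Bool d) → (∀ t → lookup cs t ≡ false) → cs ≡ replicate d false
all-false Vec.[]       _ = refl
all-false (c Vec.∷ cs) h = cong₂ Vec._∷_ (h Fin.zero) (all-false cs λ t → h (Fin.suc t))

zero≢suc : ∀ {d} {s : Fin d} → ¬ Fin.zero ≡ Fin.suc s
zero≢suc ()

module _ {r n : ℕ} where

  lincomb-zero : ∀ {d} (bs : Vec (Poly r n) d) → lincomb (replicate d false) bs ≡ []
  lincomb-zero Vec.[]       = refl
  lincomb-zero (b Vec.∷ bs) = lincomb-zero bs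

  lincomb-unit : ∀ {d} (bs : Vec (Poly r n) d) k → lincomb (unit k) bs ≈ₚ lookup bs k
  lincomb-unit (b Vec.∷ bs) Fin.zero    m = cong (λ p → coeff p m) (trans (cong (b ++_) (lincomb-zero bs)) (++-identityʳ b))
  lincomb-unit (b Vec.∷ bs) (Fin.suc k) = lincomb-unit bs k

  coeff-if : ∀ c (p : Poly r n) m → coeff (if c then p else 0ₚ) m ≡ c ∧ coeff p m
  coeff-if true  p m = refl
  coeff-if false p m = refl

  lincomb-xor : ∀ {d} (c₁ c₂ : Vec Bool d) (bs : Vec (Poly r n) d) →
    lincomb (zipWith _xor_ c₁ c₂) bs ≈ₚ (lincomb c₁ bs ++ lincomb c₂ bs)
  lincomb-xor Vec.[] Vec.[] Vec.[] m = refl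
  lincomb-xor (a Vec.∷ c₁) (b Vec.∷ c₂) (p Vec.∷ bs) m
    rewrite coeff-++ (if a xor b then p else 0ₚ) (lincomb (zipWith _xor_ c₁ c₂) bs) m
          | coeff-++ ((if a then p else 0ₚ) ++ lincomb c₁ bs) ((if b then p else 0ₚ) ++ lincomb c₂ bs) m
          | coeff-++ (if a then p else 0ₚ) (lincomb c₁ bs) m | coeff-++ (if b then p else 0ₚ) (lincomb c₂ bs) m
          | coeff-if (a xor b) p m | coeff-if a p m | coeff-if b p m | lincomb-xor c₁ c₂ bs m
          | coeff-++ (lincomb c₁ bs) (lincomb c₂ bs) m =
    solve 5 (λ a b q x y → ((a :+ b) :* q) :+ (x :+ y) := ((a :* q) :+ x) :+ ((b :* q) :+ y)) refl
      a b (coeff p m) (coeff (lincomb c₁ bs) m) (coeff (lincomb c₂ bs) m)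

  basis : ∀ {d} → Vec (Array r n) d → Vec (Poly r n) d
  basis = Vec.map λ P → basisMon P ∷ []

  parity-lincomb-∷ : (G : Mon r n → Bool) → ∀ {d} c (cs : Vec Bool d) P (Ps : Vec (Array r n) d) →
    parity G (lincomb (c Vec.∷ cs) (basis (P Vec.∷ Ps))) ≡ (c ∧ G (basisMon P)) xor parity G (lincomb cs (basis Ps))
  parity-lincomb-∷ G c cs P Ps =
    trans (parity-++ G (if c then basisMon P ∷ [] else 0ₚ) (lincomb cs (basis Ps))) (cong (_xor parity G (lincomb cs (basis Ps))) (term c))
    where
    term : ∀ c → parity G (if c then basisMon P ∷ [] else 0ₚ) ≡ c ∧ G (basisMon P)
    term true  = xor-identityʳ (G (basisMon P))
    term false = refl

  lincomb-vanishes : (G : Mon r n → Bool) → ∀ {d} (cs : Vec Bool d) (Ps : Vec (Array r n) d) →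
    (∀ s → G (basisMon (lookup Ps s)) ≡ false) → parity G (lincomb cs (basis Ps)) ≡ false
  lincomb-vanishes G Vec.[]       Vec.[]       h = refl
  lincomb-vanishes G (c Vec.∷ cs) (P Vec.∷ Ps) h
    rewrite parity-lincomb-∷ G c cs P Ps | h Fin.zero | lincomb-vanishes G cs Ps (λ s → h (Fin.suc s)) =
    trans (xor-identityʳ _) (∧-zeroʳ c)

  lincomb-coordinate : (G : Mon r n → Bool) → ∀ {d} (cs : Vec Bool d) (Ps : Vec (Array r n) d) t →
    (∀ s → G (basisMon (lookup Ps s)) ≡ true → s ≡ t) → G (basisMon (lookup Ps t)) ≡ true →
    parity G (lincomb cs (basis Ps)) ≡ lookup cs t
  lincomb-coordinate G (c Vec.∷ cs) (P Vec.∷ Ps) Fin.zero only hit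
    rewrite parity-lincomb-∷ G c cs P Ps | hit
          | lincomb-vanishes G cs Ps (λ s → ¬true⇒false λ e → zero≢suc (sym (only (Fin.suc s) e))) =
    trans (xor-identityʳ _) (∧-identityʳ c)
  lincomb-coordinate G (c Vec.∷ cs) (P Vec.∷ Ps) (Fin.suc t) only hit
    rewrite parity-lincomb-∷ G c cs P Ps | ¬true⇒false {G (basisMon P)} (λ e → zero≢suc (only Fin.zero e))
          | ∧-zeroʳ c = lincomb-coordinate G cs Ps t (λ s e → suc-injective (only (Fin.suc s) e)) hit

  encode-wd : {P Q : Array r n} → P ≈ₐ Q → encode P ≐ encode Q
  encode-wd {P} {Q} e i j k = trans (encode-cell P i j k) (trans (cong (λ c → cellCode c k) (e i j)) (sym (encode-cell Q i j k)))

  exactly-basis : (P Q : Array r n) → exactly (encode Q) (basisMon P) ≡ true → P ≈ₐ Q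
  exactly-basis P Q e = encode-injective P Q λ i j k →
    trans (sym (supp-monOf (encode P) i j k)) (does-true (supp (basisMon P) ≐? encode Q) e i j k)

  exactly-basis-self : (P : Array r n) → exactly (encode P) (basisMon P) ≡ true
  exactly-basis-self P = dec-true (supp (basisMon P) ≐? encode P) (supp-monOf (encode P))

  quotient-basis : ∀ {c} → HasCard _≈ₐ_ (IsSOR {r} {n}) c → HasQuotientDim r n c
  quotient-basis {c} (Ps , sor , distinct , complete) = basis Ps , spanning , independent
    where
    -- independence: apply the functional "support exactly encode P_t" for each t
    independent : ∀ cs → InI (lincomb cs (basis Ps)) → cs ≡ replicate c false
    independent cs I = all-false cs λ t → trans
      (sym (lincomb-coordinate (exactly (encode (lookup Ps t))) cs Ps t
        (λ s e → distinct s t (exactly-basis (lookup Ps s) (lookup Ps t) e)) (exactly-basis-self (lookup Ps t))))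
      (exactly-annihilates-I (sor⇒good (lookup Ps t) (sor t)) (lincomb cs (basis Ps)) I)

    -- spanning: a monomial reduces to its squarefree part, which is 0 or a basis monomial
    monomial : ∀ μ → ∃ λ cs → (μ ∷ []) ≡ᴵ lincomb cs (basis Ps)
    monomial μ with good-or-violated (supp μ)
    ... | inj₂ v = replicate c false , subst ((μ ∷ []) ≡ᴵ_) (sym (lincomb-zero (basis Ps))) (mod-I (violated⇒InI μ v))
    ... | inj₁ G with complete (decode (supp μ)) (decode-sor G)
    ...   | k , Q≈Pk = unit k , ≡ᴵ-trans (squarefree-reduction μ) (≈ₚ⇒≡ᴵ λ m → begin
            coeff (monOf (supp μ) ∷ []) m                  ≡⟨ ≈ₚ-∷ {p = []} {q = []} (monOf-wd same-support) (λ _ → refl) m ⟩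
            coeff (basisMon (lookup Ps k) ∷ []) m          ≡⟨ cong (λ p → coeff p m) (lookup-map k (λ P → basisMon P ∷ []) Ps) ⟨
            coeff (lookup (basis Ps) k) m                  ≡⟨ lincomb-unit (basis Ps) k m ⟨
            coeff (lincomb (unit k) (basis Ps)) m          ∎)
      where
      open ≡-Reasoning
      same-support : supp μ ≐ encode (lookup Ps k)
      same-support i j k' = trans (sym (encode-decode G i j k')) (encode-wd Q≈Pk i j k')

    span : ∀ f → ∃ λ cs → f ≡ᴵ lincomb cs (basis Ps)
    span []      = replicate c false , subst ([] ≡ᴵ_) (sym (lincomb-zero (basis Ps))) (≈ₚ⇒≡ᴵ λ _ → refl)
    span (μ ∷ f) with monomial μ | span f
    ... | c₁ , e₁ | c₂ , e₂ = zipWith _xor_ c₁ c₂ ,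
      ≡ᴵ-trans (≡ᴵ-++ {p = μ ∷ []} {q = f} e₁ e₂) (≈ₚ⇒≡ᴵ λ m → sym (lincomb-xor c₁ c₂ (basis Ps) m))

    spanning : ∀ f → ∃ λ cs → InI (f -ₚ lincomb cs (basis Ps))
    spanning f = proj₁ (span f) , difference∈I (proj₂ (span f))

module _ {A : Set} where

  extend : ∀ {m} → A → (Fin m → A) → Fin (suc m) → A
  extend a f Fin.zero    = a
  extend a f (Fin.suc i) = f i

  functions : (m : ℕ) → List A → List (Fin m → A)
  functions zero    xs = (λ ()) ∷ []
  functions (suc m) xs = concatMap (λ a → map (extend a) (functions m xs)) xs

  functions-complete : (R : A → A → Set) → ∀ m xs (f : Fin m → A) → (∀ i → Any (R (f i)) xs) →
    Any (λ g → ∀ i → R (f i) (g i)) (functions m xs)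
  functions-complete R zero    xs f _ = here λ ()
  functions-complete R (suc m) xs f h = AnyP.concatMap⁺ _ (Any.map (λ {a} Ra → AnyP.map⁺
    (Any.map (λ Rg → λ { Fin.zero → Ra ; (Fin.suc i) → Rg i }) (functions-complete R m xs (f ∘ Fin.suc) (h ∘ Fin.suc))))
    (h Fin.zero))

  lookup-fromList : {P : A → Set} → ∀ xs → All P xs → ∀ k → P (Vec.lookup (Vec.fromList xs) k)
  lookup-fromList (x ∷ xs) (p ∷ ps) Fin.zero    = p
  lookup-fromList (x ∷ xs) (p ∷ ps) (Fin.suc k) = lookup-fromList xs ps k

  hasCard-fromList : {_≈_ : A → A → Set} {Pr : A → Set} → (∀ {a b} → a ≈ b → b ≈ a) → ∀ xs →
    All Pr xs → AllPairs (λ a b → ¬ a ≈ b) xs → (∀ a → Pr a → Any (a ≈_) xs) → HasCard _≈_ Pr (length xs)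
  hasCard-fromList {_≈_} {Pr} ≈-sym xs all distinct complete =
    Vec.fromList xs , lookup-fromList xs all , injective xs distinct , λ a p → index xs (complete a p)
    where
    injective : ∀ ys → AllPairs (λ a b → ¬ a ≈ b) ys → ∀ k l → Vec.lookup (Vec.fromList ys) k ≈ Vec.lookup (Vec.fromList ys) l → k ≡ l
    injective (y ∷ ys) (y≉ ∷ d) Fin.zero    Fin.zero    e = refl
    injective (y ∷ ys) (y≉ ∷ d) Fin.zero    (Fin.suc l) e = ⊥-elim (lookup-fromList ys y≉ l e)
    injective (y ∷ ys) (y≉ ∷ d) (Fin.suc k) Fin.zero    e = ⊥-elim (lookup-fromList ys y≉ k (≈-sym e))
    injective (y ∷ ys) (y≉ ∷ d) (Fin.suc k) (Fin.suc l) e = cong Fin.suc (injective ys d k l e)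
    index : ∀ {a} ys → Any (a ≈_) ys → ∃ λ k → a ≈ Vec.lookup (Vec.fromList ys) k
    index (y ∷ ys) (here e)  = Fin.zero , e
    index (y ∷ ys) (there p) = let k , e = index ys p in Fin.suc k , e

sum-concatMap : {A : Set} (f : A → List ℕ) (xs : List A) → sum (concatMap f xs) ≡ sum (map (sum ∘ f) xs)
sum-concatMap f []       = refl
sum-concatMap f (a ∷ xs) = trans (sum-++ (f a) (concatMap f xs)) (cong (sum (f a) +_) (sum-concatMap f xs))

sum-zeros : ∀ n → sum (tabulate {n = n} λ _ → 0) ≡ 0
sum-zeros zero    = refl
sum-zeros (suc n) = sum-zeros n

sum-indicator : ∀ {n} (s : Fin n) → sum (tabulate λ k → bit (does (s ≟ᶠ k))) ≡ 1
sum-indicator {suc n} Fin.zero    = cong suc (sum-zeros n)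
sum-indicator {suc n} (Fin.suc s) = sum-indicator s

cell-degree : ∀ {n} (c : Maybe (Fin n)) → sum (map (λ k → bit (cellCode c k)) (allFin n)) ≡ filled c
cell-degree {n} c = trans (cong sum (map-tabulate {n = n} (λ k → k) (λ k → bit (cellCode c k)))) (count c)
  where
  count : ∀ c → sum (tabulate λ k → bit (cellCode c k)) ≡ filled c
  count nothing  = sum-zeros n
  count (just s) = sum-indicator s

module _ {r n : ℕ} where

  deg-basis : (P : Array r n) → deg (basisMon P) ≡ size P
  deg-basis P = begin
    sum (T3 (basisMon P))
      ≡⟨ sum-concatMap _ (allFin r) ⟩
    sum (map (λ i → sum (concatMap (λ j → map (basisMon P i j) (allFin n)) (allFin r))) (allFin r))
      ≡⟨ cong sum (map-cong (λ i → trans (sum-concatMap _ (allFin r)) (cong sum (map-cong (cell i) (allFin r)))) (allFin r)) ⟩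
    size P ∎
    where
    open ≡-Reasoning
    cell : ∀ i j → sum (map (basisMon P i j) (allFin n)) ≡ filled (P i j)
    cell i j = trans (cong sum (map-cong (λ k → cong bit (encode-cell P i j k)) (allFin n))) (cell-degree (P i j))

  deg-wd : {μ ν : Mon r n} → μ ≈ₘ ν → deg μ ≡ deg ν
  deg-wd e = cong sum (flat-wd e)

  size-wd : {P Q : Array r n} → P ≈ₐ Q → size P ≡ size Q
  size-wd e = cong sum (map-cong (λ i → cong sum (map-cong (λ j → cong filled (e i j)) (allFin r))) (allFin r))

  sor-wd : {P Q : Array r n} → P ≈ₐ Q → IsSOR P → IsSOR Q
  sor-wd {P} {Q} P≈Q S = good⇒sor Q (good-downward (λ i j k e → trans (encode-wd P≈Q i j k) e) (sor⇒good P S))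

  basisMon-wd : {P Q : Array r n} → P ≈ₐ Q → basisMon P ≈ₘ basisMon Q
  basisMon-wd e = monOf-wd (encode-wd e)

  basisMon-injective : {P Q : Array r n} → basisMon P ≈ₘ basisMon Q → P ≈ₐ Q
  basisMon-injective {P} {Q} e = encode-injective P Q λ i j k → bit-injective (e i j k)
    where
    bit-injective : ∀ {b c} → bit b ≡ bit c → b ≡ c
    bit-injective {true}  {true}  _ = refl
    bit-injective {false} {false} _ = refl

  ≈ₐ-sym : {P Q : Array r n} → P ≈ₐ Q → Q ≈ₐ P
  ≈ₐ-sym e i j = sym (e i j)

  _≈ₐ?_ : (P Q : Array r n) → Dec (P ≈ₐ Q)
  P ≈ₐ? Q = all? λ i → all? λ j → Maybe.≡-dec _≟ᶠ_ (P i j) (Q i j)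

  arraySetoid : DecSetoid 0ℓ 0ℓ
  arraySetoid = record
    { Carrier = Array r n ; _≈_ = _≈ₐ_
    ; isDecEquivalence = record
      { isEquivalence = record { refl = λ _ _ → refl ; sym = ≈ₐ-sym ; trans = λ e f i j → trans (e i j) (f i j) }
      ; _≟_ = _≈ₐ?_ } }

  good? : (a : Point r n) → Dec (Good a)
  good? a with good-or-violated a
  ... | inj₁ G              = yes G
  ... | inj₂ (g , gen , ev) = no λ G → true≢false (trans (sym (trans (xor-identityʳ (evalₘ a g)) ev)) (good⇒gen-vanishes G gen))

  sor? : (P : Array r n) → Dec (IsSOR P)
  sor? P = map′ (good⇒sor P) (sor⇒good P) (good? (encode P))

  cellValues : List (Maybe (Fin n))
  cellValues = nothing ∷ map just (allFin n)

  arrays : List (Array r n)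
  arrays = functions r (functions r cellValues)

  arrays-complete : ∀ P → Any (P ≈ₐ_) arrays
  arrays-complete P = functions-complete (λ g h → ∀ j → g j ≡ h j) r (functions r cellValues) P λ i →
    functions-complete _≡_ r cellValues (P i) λ j → cell (P i j)
    where
    cell : ∀ c → Any (c ≡_) cellValues
    cell nothing  = here refl
    cell (just s) = there (AnyP.map⁺ (Any.map (cong just) (∈-allFin s)))

  sors : List (Array r n)
  sors = deduplicate _≈ₐ?_ (filter sor? arrays)

  filter-complete : ∀ {Pr : Array r n → Set} (Pr? : ∀ P → Dec (Pr P)) → (∀ {P Q} → P ≈ₐ Q → Pr P → Pr Q) →
    ∀ {xs} P → Pr P → Any (P ≈ₐ_) xs → Any (P ≈ₐ_) (filter Pr? xs)
  filter-complete Pr? Pr-wd P p P∈xs with AnyP.filter⁺ Pr? P∈xs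
  ... | inj₁ P∈ = P∈
  ... | inj₂ ¬pr = ⊥-elim (¬pr (Pr-wd (AnyP.lookup-result P∈xs) p))

  sors-sor : All IsSOR sors
  sors-sor = AllP.deduplicate⁺ _≈ₐ?_ (AllP.all-filter sor? arrays)

  sors-distinct : AllPairs (λ P Q → ¬ P ≈ₐ Q) sors
  sors-distinct = UniqueSetoid.deduplicate-! arraySetoid (filter sor? arrays)

  sors-complete : ∀ P → IsSOR P → Any (P ≈ₐ_) sors
  sors-complete P S = AnyP.deduplicate⁺ _≈ₐ?_ (λ Q≈R P≈R i j → trans (P≈R i j) (sym (Q≈R i j)))
    (filter-complete sor? sor-wd P S (arrays-complete P))

  sor-card : HasCard _≈ₐ_ (IsSOR {r} {n}) (length sors)
  sor-card = hasCard-fromList ≈ₐ-sym sors sors-sor sors-distinct sors-complete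

  module Graded (m : ℕ) where

    sized : List (Array r n)
    sized = filter (λ P → size P ≟ℕ m) sors

    sized-card : HasCard _≈ₐ_ (IsSORm {r} {n} m) (length sized)
    sized-card = hasCard-fromList ≈ₐ-sym sized
      (All.zip (AllP.filter⁺ (λ P → size P ≟ℕ m) sors-sor , AllP.all-filter (λ P → size P ≟ℕ m) sors))
      (AllPairsP.filter⁺ (λ P → size P ≟ℕ m) sors-distinct)
      (λ P (S , s) → filter-complete (λ P → size P ≟ℕ m) (λ e s′ → trans (sym (size-wd e)) s′) P s (sors-complete P S))

    standard-card : HasCard _≈ₘ_ (IsStandardOfDeg {r} {n} m) (length sized)
    standard-card = subst (HasCard _≈ₘ_ (IsStandardOfDeg m)) (length-map basisMon sized)
      (hasCard-fromList ≈ₘ-sym (map basisMon sized)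
        (AllP.map⁺ (All.map (λ {P} (S , s) → basis-standard P S , trans (deg-basis P) s)
          (All.zip (AllP.filter⁺ (λ P → size P ≟ℕ m) sors-sor , AllP.all-filter (λ P → size P ≟ℕ m) sors))))
        (AllPairsP.map⁺ (AllPairs.map (λ P≉Q e → P≉Q (basisMon-injective e)) (AllPairsP.filter⁺ (λ P → size P ≟ℕ m) sors-distinct)))
        complete)
      where
      complete : ∀ μ → IsStandardOfDeg m μ → Any (μ ≈ₘ_) (map basisMon sized)
      complete μ (standard , d) with standard⇒basis μ standard
      ... | P , S , μ≈P = AnyP.map⁺ (Any.map (λ P≈Q → ≈ₘ-trans μ≈P (basisMon-wd P≈Q))
            (filter-complete (λ P → size P ≟ℕ m) (λ e s′ → trans (sym (size-wd e)) s′) P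
              (trans (sym (deg-basis P)) (trans (sym (deg-wd μ≈P)) d)) (sors-complete P S)))

theorem3 : (r n : ℕ) → 0 < r → 0 < n →
    ZeroDimensional r n
    × (∀ (P : Array r n) → IsSOR P → IsZeroOfI (encode P))
    × (∀ (P Q : Array r n) → IsSOR P → IsSOR Q →
         (∀ i j k → encode P i j k ≡ encode Q i j k) → P ≈ₐ Q)
    × (∀ (a : Point r n) → IsZeroOfI a →
         ∃ λ (P : Array r n) → IsSOR P × (∀ i j k → encode P i j k ≡ a i j k))
    × (∃ λ c → HasCard _≈ₐ_ (IsSOR {r} {n}) c × HasQuotientDim r n c)
    × (∀ (m : ℕ) → ∃ λ c →
         HasCard _≈ₐ_ (IsSORm {r} {n} m) c × HasCard _≈ₘ_ (IsStandardOfDeg {r} {n} m) c)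
theorem3 r n _ _ =
  (length (sors {r} {n}) , dimension) ,
  (λ P S → good⇒zero (sor⇒good P S)) ,
  (λ P Q _ _ → encode-injective P Q) ,
  (λ a Z → decode a , decode-sor (zero⇒good Z) , encode-decode (zero⇒good Z)) ,
  (length (sors {r} {n}) , sor-card , dimension) ,
  (λ m → length (Graded.sized {r} {n} m) , Graded.sized-card m , Graded.standard-card m)
  where
  dimension : HasQuotientDim r n (length (sors {r} {n}))
  dimension = quotient-basis sor-card
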